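{- Let $q$ be a prime power and $1\le\ell\le m$ integers. For $r=1,\dots,m$, the $r$-th generalized Hamming weight $\hat d_r$ of $\hat C_{\det}(1;\ell,m)$ meets the Griesmer–Wei bound and is given by $$\hat d_r=q^{\ell+m-2}+q^{\ell+m-3}+\cdots+q^{\ell+m-r-1}=q^{\ell+m-r-1}\frac{q^r-1}{q-1}.$$ In particular, if $r\le\ell$, then $\hat d_r=\hat w_r$, where $\hat w_r=w_H(\hat c_{\tau_r})$ with $\tau_r=X_{11}+\cdots+X_{rr}$.
   Context: $\mathbb{F}_q$ is the finite field with $q$ elements; $X=(X_{ij})$ is an $\ell\times m$ matrix of indeterminates; $\mathbb{F}_q[X]_1$ is the space of linear homogeneous polynomials $f=\sum f_{ij}X_{ij}$ (with $0$), evaluated at a matrix $M$ by $f(M)=\sum f_{ij}M_{ij}$. Let $\hat M_1,\dots,\hat M_{\hat n}$ be representatives, one from each class of nonzero scalar multiples, of the matrices in $M_{\ell\times m}(\mathbb{F}_q)$ of rank exactly $1$; $\hat c_f=(f(\hat M_1),\dots,f(\hat M_{\hat n}))$ and $\hat C_{\det}(1;\ell,m)=\{\hat c_f\}$. $w_H$ is Hamming weight. For a code $C$, the support weight of a subcode $D$ is $\|D\|=|\{i:\exists c\in D,\ c_i\neq0\}|$ and $d_r(C)=\min\{\|D\|:D\subseteq C,\ \dim D=r\}$. The Griesmer–Wei bound is $d_r\ge\sum_{j=0}^{r-1}\lceil d_1/q^j\rceil$. -}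

module Defs where

open import Level using (0ℓ)
open import Data.Nat as ℕ using (ℕ; zero; suc; _∸_; _^_)
open import Data.Nat.DivMod using (_/_)
open import Data.Fin using (Fin; zero; suc; toℕ)
open import Data.Fin.Subset using (Subset; _∈_; ∣_∣)
open import Data.Product using (Σ; ∃; ∃-syntax; _×_; _,_)
open import Data.List using (List; map; upTo)
open import Data.Nat.ListAction using (sum)
open import Relation.Binary.PropositionalEquality using (_≡_; _≢_)
open import Relation.Nullary using (¬_; yes; no)
open import Relation.Binary.Definitions using (DecidableEquality)
open import Algebra.Structures using (IsCommutativeRing)
open import Function.Bundles using (_↔_)
open import Data.Nat using (_<?_)
open import Data.Fin.Properties using () renaming (_≟_ to _≟ᶠ_)

record FiniteField (q : ℕ) : Set₁ where
  infixl 6 _+_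
  infixl 7 _*_
  field
    Carrier : Set
    _+_ _*_ : Carrier → Carrier → Carrier
    -_ : Carrier → Carrier
    0# 1# : Carrier
    isCommutativeRing : IsCommutativeRing _≡_ _+_ _*_ -_ 0# 1#
    0≢1 : 0# ≢ 1#
    inverse : ∀ x → x ≢ 0# → ∃[ y ] (x * y ≡ 1#)
    _≟_ : DecidableEquality Carrier
    enumeration : Fin q ↔ Carrier

-- ⌈ a / b ⌉ (for b ≥ 1; set to 0 when b = 0, never used there)
⌈_/_⌉ : ℕ → ℕ → ℕ
⌈ a / zero ⌉ = 0
⌈ a / suc b ⌉ = (a ℕ.+ b) / suc b

sumℕ : ℕ → (ℕ → ℕ) → ℕ
sumℕ r f = sum (map f (upTo r))

Count : ∀ {n} → (Fin n → Set) → ℕ → Set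
Count {n} P s = ∃[ S ] ((∀ i → (i ∈ S → P i) × (P i → i ∈ S)) × ∣ S ∣ ≡ s)

module OverField {q : ℕ} (F : FiniteField q) where
  open FiniteField F

  ∑ : (n : ℕ) → (Fin n → Carrier) → Carrier
  ∑ zero f = 0#
  ∑ (suc n) f = f zero + ∑ n (λ i → f (suc i))

  Mat : ℕ → ℕ → Set
  Mat ℓ m = Fin ℓ → Fin m → Carrier

  IsRank1 : ∀ {ℓ m} → Mat ℓ m → Set
  IsRank1 {ℓ} {m} M =
    (∃[ i ] ∃[ j ] (M i j ≢ 0#)) ×
    (Σ (Fin ℓ → Carrier) λ u → Σ (Fin m → Carrier) λ v →
       ∀ (i : Fin ℓ) (j : Fin m) → M i j ≡ u i * v j)

  ScalarMultiple : ∀ {ℓ m} → Mat ℓ m → Mat ℓ m → Set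
  ScalarMultiple M N = ∃[ c ] (c ≢ 0# × (∀ i j → M i j ≡ c * N i j))

  -- M̂ : Fin n̂ → Mat ℓ m is a system of representatives, one from each class
  -- of nonzero scalar multiples, of the rank-1 matrices.
  IsProjReps : ∀ {ℓ m n̂} → (Fin n̂ → Mat ℓ m) → Set
  IsProjReps {ℓ} {m} {n̂} M̂ =
    (∀ k → IsRank1 (M̂ k)) ×
    (∀ (M : Mat ℓ m) → IsRank1 M → ∃[ k ] ScalarMultiple M (M̂ k)) ×
    (∀ k k' → ScalarMultiple (M̂ k) (M̂ k') → k ≡ k')

  -- linear homogeneous polynomials f = Σ f_ij X_ij, given by coefficients
  LinForm : ℕ → ℕ → Set
  LinForm = Mat

  eval : ∀ {ℓ m} → LinForm ℓ m → Mat ℓ m → Carrier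
  eval {ℓ} {m} f M = ∑ ℓ (λ i → ∑ m (λ j → f i j * M i j))

  codeword : ∀ {ℓ m n̂} → (Fin n̂ → Mat ℓ m) → LinForm ℓ m → (Fin n̂ → Carrier)
  codeword M̂ f k = eval f (M̂ k)

  HammingWeight : ∀ {n} → (Fin n → Carrier) → ℕ → Set
  HammingWeight c s = Count (λ i → c i ≢ 0#) s

  Code : ℕ → Set₁
  Code n = (Fin n → Carrier) → Set

  Cdet : ∀ {ℓ m n̂} → (Fin n̂ → Mat ℓ m) → Code n̂
  Cdet M̂ c = ∃[ f ] (∀ k → c k ≡ codeword M̂ f k)

  lincomb : ∀ {n} r → (Fin r → Carrier) → (Fin r → Fin n → Carrier) → Fin n → Carrier
  lincomb r a b k = ∑ r (λ s → a s * b s k)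

  -- An r-dimensional subcode D ⊆ C, given by a basis b₁,…,b_r of D:
  -- vectors in C that are linearly independent.  D = span(b).
  IsSubcodeBasis : ∀ {n} → Code n → (r : ℕ) → (Fin r → Fin n → Carrier) → Set
  IsSubcodeBasis {n} C r b =
    (∀ s → C (b s)) ×
    (∀ a → (∀ k → lincomb r a b k ≡ 0#) → ∀ s → a s ≡ 0#)

  SupportWeight : ∀ {n} r → (Fin r → Fin n → Carrier) → ℕ → Set
  SupportWeight r b s = Count (λ i → ∃[ a ] (lincomb r a b i ≢ 0#)) s

  IsGHW : ∀ {n} → Code n → ℕ → ℕ → Set
  IsGHW C r d =
    (∃[ b ] (IsSubcodeBasis C r b × SupportWeight r b d)) ×
    (∀ b s → IsSubcodeBasis C r b → SupportWeight r b s → d ℕ.≤ s)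

  τ : ∀ {ℓ m} → ℕ → LinForm ℓ m
  τ r i j with toℕ i ℕ.≟ toℕ j | toℕ i <? r
  ... | yes _ | yes _ = 1#
  ... | _     | _     = 0#

module Submission where

-- The codeword ĉ_f lists f(M̂_k) over representatives M̂_k of the rank-one matrices
-- up to nonzero scalars, and every count below is a sum of indicators.
--  * Orbit counting: each representative accounts for exactly (q-1)² pairs of nonzero
--    vectors (u, v) with u vᵀ in its class, so counts over representatives become counts
--    over pairs, where f(u vᵀ) = (uᵀ f) · v is a linear functional of v.  This gives a
--    weight formula and the minimum weight q^(ℓ-1) q^(m-1) of nonzero codewords.
--  * Averaging: the weights of the q^r codewords of an r-dimensional subcode D add up
--    to ‖D‖ q^(r-1) (q-1), so (q^r - 1) q^(ℓ+m-2) ≤ ‖D‖ q^(r-1) (q-1), i.e. ‖D‖ ≥ d_r.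
--  * The subcode spanned by X_11, …, X_1r has support exactly d_r, and ĉ_τ for
--    τ_r = X_11 + ⋯ + X_rr has weight d_r when r ≤ ℓ; both again by orbit counting.
--  * A geometric series and exact ceilings ⌈q^N / q^j⌉ = q^(N-j) give the closed forms.

open import Defs
open import Data.Nat as ℕ using (ℕ; zero; suc; _∸_; _^_; _≤_; _<_; z≤n; s≤s; NonZero)
import Data.Nat.Properties as ℕₚ
open import Data.Fin as Fin using (Fin; zero; suc; toℕ)
import Data.Fin.Properties as Finₚ
open import Data.Fin.Subset using (Subset; _∈_; ∣_∣)
open import Data.Fin.Subset.Properties using (_∈?_)
open import Data.Bool using (Bool; true; false)
open import Data.Vec as Vec using (Vec; []; _∷_; lookup; tabulate; there)
import Data.Vec.Properties as Vecₚ
open import Data.Product using (∃-syntax; _×_; _,_; proj₁; proj₂)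
open import Data.Empty using (⊥-elim)
open import Data.Unit using (⊤; tt)
open import Relation.Binary.PropositionalEquality
open import Relation.Binary.Definitions using (DecidableEquality)
open import Relation.Nullary using (¬_; Dec; yes; no; _×-dec_; ¬?)
import Relation.Nullary.Decidable as Dec
open import Level using (0ℓ)
open import Algebra.Bundles using (CommutativeRing)
open import Function.Bundles using (Inverse)
import Algebra.Properties.Semiring.Sum as SemiringSum
import Data.List as List
import Data.List.Properties as Listₚ
import Data.Nat.ListAction as ListAction
import Data.Nat.ListAction.Properties as ListActionₚ
open import Data.Nat.DivMod using (_/_; +-distrib-/-∣ˡ; m*n/n≡m; m<n⇒m/n≡0)
open import Data.Nat.Divisibility using (divides)
open import Data.Nat.Primality using (Prime)
import Algebra.Properties.CommutativeSemigroup as CommutativeSemigroupProperties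
open SemiringSum ℕₚ.+-*-semiring
  using (sum; sum-syntax; sum-cong-≗; sum-replicate-zero; ∑-distrib-+; ∑-comm; *-distribˡ-sum; *-distribʳ-sum)

open CommutativeSemigroupProperties ℕₚ.*-commutativeSemigroup
  using () renaming (interchange to ℕ-interchange; x∙yz≈y∙xz to ℕ-leftComm)

𝟙 : ∀ {p} {P : Set p} → Dec P → ℕ
𝟙 (yes _) = 1
𝟙 (no _)  = 0

𝟙-cong : ∀ {p q} {P : Set p} {Q : Set q} (d : Dec P) (e : Dec Q) →
         (P → Q) → (Q → P) → 𝟙 d ≡ 𝟙 e
𝟙-cong (yes _) (yes _) _ _ = refl
𝟙-cong (yes p) (no ¬q) f _ = ⊥-elim (¬q (f p))
𝟙-cong (no ¬p) (yes q) _ g = ⊥-elim (¬p (g q))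
𝟙-cong (no _)  (no _)  _ _ = refl

𝟙-yes : ∀ {p} {P : Set p} (d : Dec P) → P → 𝟙 d ≡ 1
𝟙-yes (yes _) _ = refl
𝟙-yes (no ¬p) p = ⊥-elim (¬p p)

𝟙-no : ∀ {p} {P : Set p} (d : Dec P) → ¬ P → 𝟙 d ≡ 0
𝟙-no (yes p) ¬p = ⊥-elim (¬p p)
𝟙-no (no _)  _  = refl

𝟙-× : ∀ {p q} {P : Set p} {Q : Set q} (d : Dec P) (e : Dec Q) → 𝟙 (d ×-dec e) ≡ 𝟙 d ℕ.* 𝟙 e
𝟙-× (yes _) (yes _) = refl
𝟙-× (yes _) (no _)  = refl
𝟙-× (no _)  (yes _) = refl
𝟙-× (no _)  (no _)  = refl

𝟙-¬ : ∀ {p} {P : Set p} (d : Dec P) → 𝟙 d ℕ.+ 𝟙 (¬? d) ≡ 1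
𝟙-¬ (yes _) = refl
𝟙-¬ (no _)  = refl

𝟙-absorb : ∀ {p q} {P : Set p} {Q : Set q} (d : Dec P) (e : Dec Q) → (Q → P) → 𝟙 d ℕ.* 𝟙 e ≡ 𝟙 e
𝟙-absorb (yes _) e       _   = ℕₚ.+-identityʳ (𝟙 e)
𝟙-absorb (no _)  (no _)  _   = refl
𝟙-absorb (no ¬p) (yes q) q⇒p = ⊥-elim (¬p (q⇒p q))

∑-const : ∀ n c → ∑[ i < n ] c ≡ n ℕ.* c
∑-const zero    c = refl
∑-const (suc n) c = cong (c ℕ.+_) (∑-const n c)

∑-mono : ∀ n {f g : Fin n → ℕ} → (∀ i → f i ≤ g i) → sum f ≤ sum g
∑-mono zero    f≤g = z≤n
∑-mono (suc n) f≤g = ℕₚ.+-mono-≤ (f≤g zero) (∑-mono n (λ i → f≤g (suc i)))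

∑-pick : ∀ n (j : Fin n) (g : Fin n → ℕ) → ∑[ i < n ] (𝟙 (i Finₚ.≟ j) ℕ.* g i) ≡ g j
∑-pick (suc n) zero g = trans
  (cong₂ ℕ._+_ (ℕₚ.*-identityˡ (g zero)) (trans (sum-cong-≗ λ i →
     cong (ℕ._* g (suc i)) (𝟙-no (suc i Finₚ.≟ zero) λ ())) (sum-replicate-zero n)))
  (ℕₚ.+-identityʳ (g zero))
∑-pick (suc n) (suc j) g = begin
  𝟙 (zero Finₚ.≟ suc j) ℕ.* g zero ℕ.+ ∑[ i < n ] (𝟙 (suc i Finₚ.≟ suc j) ℕ.* g (suc i))
    ≡⟨ cong₂ ℕ._+_ (cong (ℕ._* g zero) (𝟙-no (zero Finₚ.≟ suc j) λ ()))
                   (sum-cong-≗ λ i → cong (ℕ._* g (suc i))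
                     (𝟙-cong (suc i Finₚ.≟ suc j) (i Finₚ.≟ j) Finₚ.suc-injective (cong suc))) ⟩
  ∑[ i < n ] (𝟙 (i Finₚ.≟ j) ℕ.* g (suc i)) ≡⟨ ∑-pick n j (λ i → g (suc i)) ⟩
  g (suc j) ∎ where open ≡-Reasoning

∣S∣≡∑ : ∀ {n} (S : Subset n) → ∣ S ∣ ≡ ∑[ i < n ] 𝟙 (i ∈? S)
∣S∣≡∑ [] = refl
∣S∣≡∑ {suc n} (true ∷ S) = cong suc (trans (∣S∣≡∑ S) (sum-cong-≗ λ i →
  𝟙-cong (i ∈? S) (suc i ∈? (true ∷ S)) there λ { (there p) → p }))
∣S∣≡∑ {suc n} (false ∷ S) = trans (∣S∣≡∑ S) (sum-cong-≗ λ i →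
  𝟙-cong (i ∈? S) (suc i ∈? (false ∷ S)) there λ { (there p) → p })

Count⇒∑ : ∀ {n} {P : Fin n → Set} (P? : ∀ i → Dec (P i)) {s} → Count P s → s ≡ ∑[ i < n ] 𝟙 (P? i)
Count⇒∑ P? (S , S≡P , refl) =
  trans (∣S∣≡∑ S) (sum-cong-≗ λ i → 𝟙-cong (i ∈? S) (P? i) (proj₁ (S≡P i)) (proj₂ (S≡P i)))

∑⇒Count : ∀ {n} {P : Fin n → Set} (P? : ∀ i → Dec (P i)) → Count P (∑[ i < n ] 𝟙 (P? i))
∑⇒Count {n} {P} P? = S , (λ i → ∈S⇒P i , P⇒∈S i) ,
  trans (∣S∣≡∑ S) (sum-cong-≗ λ i → 𝟙-cong (i ∈? S) (P? i) (∈S⇒P i) (P⇒∈S i))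
  where
  member : ∀ {i} → Dec (P i) → Bool
  member (yes _) = true
  member (no _)  = false
  S : Subset n
  S = tabulate (λ i → member (P? i))
  ∈S⇒P : ∀ i → i ∈ S → P i
  ∈S⇒P i i∈S = extract (P? i) (trans (sym (Vecₚ.lookup∘tabulate _ i)) (Vecₚ.[]=⇒lookup i∈S))
    where
    extract : (d : Dec (P i)) → member d ≡ true → P i
    extract (yes p) _ = p
    extract (no _) ()
  P⇒∈S : ∀ i → P i → i ∈ S
  P⇒∈S i p = Vecₚ.lookup⇒[]= i S (trans (Vecₚ.lookup∘tabulate _ i) (chosen (P? i)))
    where
    chosen : (d : Dec (P i)) → member d ≡ true
    chosen (yes _) = refl
    chosen (no ¬p) = ⊥-elim (¬p p)

module OverFq {q : ℕ} (F : FiniteField q) where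
  open FiniteField F renaming (_≟_ to infix 4 _≟_)
  open OverField F

  ring : CommutativeRing 0ℓ 0ℓ
  ring = record { isCommutativeRing = isCommutativeRing }

  open CommutativeRing ring
    using ( +-identityˡ; +-identityʳ; *-assoc; *-comm; *-identityˡ; zeroˡ; zeroʳ
          ; semiring; +-abelianGroup; *-commutativeSemigroup )
  open import Algebra.Properties.Group (Algebra.Bundles.AbelianGroup.group +-abelianGroup)
    using (\\-leftDividesˡ; \\-leftDividesʳ)
  open import Algebra.Properties.CommutativeSemigroup *-commutativeSemigroup
    using (interchange; x∙yz≈y∙xz)
  module FΣ = SemiringSum semiring
  open Inverse enumeration using (to; from; strictlyInverseˡ; strictlyInverseʳ)

  1≢0 : 1# ≢ 0#
  1≢0 e = 0≢1 (sym e)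

  inv : ∀ x → x ≢ 0# → Carrier
  inv x x≢0 = proj₁ (inverse x x≢0)

  inv-r : ∀ x (x≢0 : x ≢ 0#) → x * inv x x≢0 ≡ 1#
  inv-r x x≢0 = proj₂ (inverse x x≢0)

  solve-* : ∀ {c x t} (c≢0 : c ≢ 0#) → c * x ≡ t → x ≡ inv c c≢0 * t
  solve-* {c} {x} {t} c≢0 e = begin
    x                       ≡⟨ *-identityˡ x ⟨
    1# * x                  ≡⟨ cong (_* x) (sym (inv-r c c≢0)) ⟩
    (c * inv c c≢0) * x     ≡⟨ cong (_* x) (*-comm c _) ⟩
    (inv c c≢0 * c) * x     ≡⟨ *-assoc _ c x ⟩
    inv c c≢0 * (c * x)     ≡⟨ cong (inv c c≢0 *_) e ⟩
    inv c c≢0 * t           ∎ where open ≡-Reasoning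

  unsolve-* : ∀ {c x t} (c≢0 : c ≢ 0#) → x ≡ inv c c≢0 * t → c * x ≡ t
  unsolve-* {c} {x} {t} c≢0 refl = begin
    c * (inv c c≢0 * t)     ≡⟨ *-assoc c _ t ⟨
    (c * inv c c≢0) * t     ≡⟨ cong (_* t) (inv-r c c≢0) ⟩
    1# * t                  ≡⟨ *-identityˡ t ⟩
    t                       ∎ where open ≡-Reasoning

  cancel-0 : ∀ {a b} → a ≢ 0# → a * b ≡ 0# → b ≡ 0#
  cancel-0 {a} a≢0 ab≡0 = trans (solve-* a≢0 ab≡0) (zeroʳ _)

  *-≢0 : ∀ {a b} → a ≢ 0# → b ≢ 0# → a * b ≢ 0#
  *-≢0 a≢0 b≢0 ab≡0 = b≢0 (cancel-0 a≢0 ab≡0)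

  ≢0-factorˡ : ∀ {a b} → a * b ≢ 0# → a ≢ 0#
  ≢0-factorˡ {a} {b} ab≢0 refl = ab≢0 (zeroˡ b)

  ≢0-factorʳ : ∀ {a b} → a * b ≢ 0# → b ≢ 0#
  ≢0-factorʳ {a} {b} ab≢0 refl = ab≢0 (zeroʳ a)

  *-cancelʳ : ∀ {a b c} → c ≢ 0# → a * c ≡ b * c → a ≡ b
  *-cancelʳ {a} {b} {c} c≢0 e =
    trans (solve-* c≢0 (trans (*-comm c a) e)) (sym (solve-* c≢0 (*-comm c b)))

  subtract : ∀ {a d t} → a + d ≡ t → d ≡ - a + t
  subtract {a} {d} e = trans (sym (\\-leftDividesʳ a d)) (cong (- a +_) e)

  unsubtract : ∀ {a d t} → d ≡ - a + t → a + d ≡ t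
  unsubtract {a} {t = t} e = trans (cong (a +_) e) (\\-leftDividesˡ a t)

  q≥2 : 2 ≤ q
  q≥2 = two-points (from 0#) (from 1#) λ e →
    0≢1 (trans (sym (strictlyInverseˡ 0#)) (trans (cong to e) (strictlyInverseˡ 1#)))
    where
    two-points : ∀ {n} (a b : Fin n) → a ≢ b → 2 ≤ n
    two-points {suc zero} zero zero a≢b = ⊥-elim (a≢b refl)
    two-points {suc (suc n)} _ _ _ = s≤s (s≤s z≤n)

  -- Hence q - 1 > 0, the factor cancelled from the counts below.
  q∸1>0 : 0 < q ∸ 1
  q∸1>0 = ℕₚ.∸-monoˡ-≤ 1 q≥2

  q∸1²≢0 : NonZero ((q ∸ 1) ℕ.* (q ∸ 1))
  q∸1²≢0 = ℕ.>-nonZero (ℕₚ.*-mono-< q∸1>0 q∸1>0)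

  ∑≡sum : ∀ n (f : Fin n → Carrier) → ∑ n f ≡ FΣ.sum f
  ∑≡sum zero    f = refl
  ∑≡sum (suc n) f = cong (f zero +_) (∑≡sum n (λ i → f (suc i)))

  ∑-cong : ∀ n {f g : Fin n → Carrier} → (∀ i → f i ≡ g i) → ∑ n f ≡ ∑ n g
  ∑-cong n f≗g = trans (∑≡sum n _) (trans (FΣ.sum-cong-≗ f≗g) (sym (∑≡sum n _)))

  ∑-zero : ∀ n {f : Fin n → Carrier} → (∀ i → f i ≡ 0#) → ∑ n f ≡ 0#
  ∑-zero n f≗0 = trans (∑-cong n f≗0) (trans (∑≡sum n _) (FΣ.sum-replicate-zero n))

  ∑-*ˡ : ∀ n c (f : Fin n → Carrier) → ∑ n (λ i → c * f i) ≡ c * ∑ n f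
  ∑-*ˡ n c f = trans (∑≡sum n _) (trans (sym (FΣ.*-distribˡ-sum c f)) (cong (c *_) (sym (∑≡sum n f))))

  ∑-*ʳ : ∀ n c (f : Fin n → Carrier) → ∑ n (λ i → f i * c) ≡ ∑ n f * c
  ∑-*ʳ n c f = trans (∑≡sum n _) (trans (sym (FΣ.*-distribʳ-sum c f)) (cong (_* c) (sym (∑≡sum n f))))

  ∑-swap : ∀ n m (f : Fin n → Fin m → Carrier) →
           ∑ n (λ i → ∑ m (λ j → f i j)) ≡ ∑ m (λ j → ∑ n (λ i → f i j))
  ∑-swap n m f = begin
    ∑ n (λ i → ∑ m (f i))                       ≡⟨ trans (∑≡sum n _) (FΣ.sum-cong-≗ λ i → ∑≡sum m (f i)) ⟩
    FΣ.sum (λ i → FΣ.sum (f i))                 ≡⟨ FΣ.∑-comm f ⟩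
    FΣ.sum (λ j → FΣ.sum (λ i → f i j))         ≡⟨ sym (trans (∑≡sum m _) (FΣ.sum-cong-≗ λ j → ∑≡sum n (λ i → f i j))) ⟩
    ∑ m (λ j → ∑ n (λ i → f i j))               ∎ where open ≡-Reasoning

  δ : ∀ {n} → Fin n → Fin n → Carrier
  δ i j with i Finₚ.≟ j
  ... | yes _ = 1#
  ... | no _  = 0#

  δ-same : ∀ {n} (i : Fin n) → δ i i ≡ 1#
  δ-same i with i Finₚ.≟ i
  ... | yes _  = refl
  ... | no i≢i = ⊥-elim (i≢i refl)

  δ-diff : ∀ {n} (i j : Fin n) → i ≢ j → δ i j ≡ 0#
  δ-diff i j i≢j with i Finₚ.≟ j
  ... | yes i≡j = ⊥-elim (i≢j i≡j)
  ... | no _    = refl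

  δ-injective : ∀ {n m} (φ : Fin n → Fin m) → (∀ {i j} → φ i ≡ φ j → i ≡ j) → ∀ i j → δ (φ i) (φ j) ≡ δ i j
  δ-injective φ φ-inj i j with i Finₚ.≟ j
  ... | yes refl = δ-same (φ i)
  ... | no i≢j   = δ-diff (φ i) (φ j) (λ e → i≢j (φ-inj e))

  ∑-δ : ∀ n (j : Fin n) (g : Fin n → Carrier) → ∑ n (λ i → δ i j * g i) ≡ g j
  ∑-δ (suc n) zero g = begin
    δ {suc n} zero zero * g zero + ∑ n (λ i → δ (suc i) zero * g (suc i))
      ≡⟨ cong₂ _+_ (trans (cong (_* g zero) (δ-same {suc n} zero)) (*-identityˡ _))
                   (∑-zero n λ i → trans (cong (_* g (suc i)) (δ-diff (suc i) zero λ ())) (zeroˡ _)) ⟩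
    g zero + 0#  ≡⟨ +-identityʳ _ ⟩
    g zero       ∎ where open ≡-Reasoning
  ∑-δ (suc n) (suc j) g = begin
    δ zero (suc j) * g zero + ∑ n (λ i → δ (suc i) (suc j) * g (suc i))
      ≡⟨ cong₂ _+_ (trans (cong (_* g zero) (δ-diff zero (suc j) λ ())) (zeroˡ _))
                   (∑-cong n λ i → cong (_* g (suc i)) (δ-injective suc Finₚ.suc-injective i j)) ⟩
    0# + ∑ n (λ i → δ i j * g (suc i))  ≡⟨ +-identityˡ _ ⟩
    ∑ n (λ i → δ i j * g (suc i))       ≡⟨ ∑-δ n j (λ i → g (suc i)) ⟩
    g (suc j)                           ∎ where open ≡-Reasoning

  ∑F : (Carrier → ℕ) → ℕ
  ∑F h = ∑[ i < q ] h (to i)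

  ∑F-cong : ∀ {g h : Carrier → ℕ} → (∀ x → g x ≡ h x) → ∑F g ≡ ∑F h
  ∑F-cong g≗h = sum-cong-≗ (λ i → g≗h (to i))

  ∑F-pick : ∀ y (g : Carrier → ℕ) → ∑F (λ x → 𝟙 (x ≟ y) ℕ.* g x) ≡ g y
  ∑F-pick y g = begin
    ∑[ i < q ] (𝟙 (to i ≟ y) ℕ.* g (to i))
      ≡⟨ sum-cong-≗ (λ i → cong (ℕ._* g (to i)) (𝟙-cong (to i ≟ y) (i Finₚ.≟ from y)
           (λ e → trans (sym (strictlyInverseʳ i)) (cong from e))
           (λ e → trans (cong to e) (strictlyInverseˡ y)))) ⟩
    ∑[ i < q ] (𝟙 (i Finₚ.≟ from y) ℕ.* g (to i))  ≡⟨ ∑-pick q (from y) (λ i → g (to i)) ⟩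
    g (to (from y))                                 ≡⟨ cong g (strictlyInverseˡ y) ⟩
    g y                                             ∎ where open ≡-Reasoning

  ∑V : (n : ℕ) → (Vec Carrier n → ℕ) → ℕ
  ∑V zero    G = G []
  ∑V (suc n) G = ∑F (λ x → ∑V n (λ v → G (x ∷ v)))

  ∑V-cong : ∀ n {G H : Vec Carrier n → ℕ} → (∀ v → G v ≡ H v) → ∑V n G ≡ ∑V n H
  ∑V-cong zero    G≗H = G≗H []
  ∑V-cong (suc n) G≗H = ∑F-cong (λ x → ∑V-cong n (λ v → G≗H (x ∷ v)))

  ∑V-+ : ∀ n (G H : Vec Carrier n → ℕ) → ∑V n (λ v → G v ℕ.+ H v) ≡ ∑V n G ℕ.+ ∑V n H
  ∑V-+ zero    G H = refl
  ∑V-+ (suc n) G H = trans (∑F-cong (λ x → ∑V-+ n (λ v → G (x ∷ v)) (λ v → H (x ∷ v)))) (∑-distrib-+ (λ i → ∑V n (λ v → G (to i ∷ v))) (λ i → ∑V n (λ v → H (to i ∷ v))))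

  ∑V-*ˡ : ∀ n c (G : Vec Carrier n → ℕ) → ∑V n (λ v → c ℕ.* G v) ≡ c ℕ.* ∑V n G
  ∑V-*ˡ zero    c G = refl
  ∑V-*ˡ (suc n) c G = trans (∑F-cong (λ x → ∑V-*ˡ n c (λ v → G (x ∷ v)))) (sym (*-distribˡ-sum c (λ i → ∑V n (λ v → G (to i ∷ v)))))

  ∑V-*ʳ : ∀ n c (G : Vec Carrier n → ℕ) → ∑V n (λ v → G v ℕ.* c) ≡ ∑V n G ℕ.* c
  ∑V-*ʳ n c G = trans (∑V-cong n (λ v → ℕₚ.*-comm (G v) c)) (trans (∑V-*ˡ n c G) (ℕₚ.*-comm c _))

  ∑V-const : ∀ n c → ∑V n (λ _ → c) ≡ q ^ n ℕ.* c
  ∑V-const zero    c = sym (ℕₚ.+-identityʳ c)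
  ∑V-const (suc n) c = trans (∑F-cong (λ _ → ∑V-const n c)) (trans (∑-const q (q ^ n ℕ.* c)) (sym (ℕₚ.*-assoc q (q ^ n) c)))

  ∑V-mono : ∀ n {G H : Vec Carrier n → ℕ} → (∀ v → G v ≤ H v) → ∑V n G ≤ ∑V n H
  ∑V-mono zero    G≤H = G≤H []
  ∑V-mono (suc n) G≤H = ∑-mono q (λ i → ∑V-mono n (λ v → G≤H (to i ∷ v)))

  ∑V-swap : ∀ n k (G : Vec Carrier n → Fin k → ℕ) →
            ∑V n (λ v → ∑[ j < k ] G v j) ≡ ∑[ j < k ] ∑V n (λ v → G v j)
  ∑V-swap zero    k G = refl
  ∑V-swap (suc n) k G = trans (∑F-cong (λ x → ∑V-swap n k (λ v → G (x ∷ v))))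
                              (∑-comm (λ i j → ∑V n (λ v → G (to i ∷ v) j)))

  ∑V-product : ∀ n k (G : Vec Carrier n → ℕ) (H : Vec Carrier k → ℕ) →
               ∑V n (λ u → ∑V k (λ v → G u ℕ.* H v)) ≡ ∑V n G ℕ.* ∑V k H
  ∑V-product n k G H = trans (∑V-cong n (λ u → ∑V-*ˡ k (G u) H)) (∑V-*ʳ n (∑V k H) G)

  infix 4 _≟v_
  _≟v_ : ∀ {n} → DecidableEquality (Vec Carrier n)
  _≟v_ = Vecₚ.≡-dec _≟_

  ∑V-pick : ∀ n (w : Vec Carrier n) (G : Vec Carrier n → ℕ) → ∑V n (λ v → 𝟙 (v ≟v w) ℕ.* G v) ≡ G w
  ∑V-pick zero    []      G = ℕₚ.+-identityʳ _
  ∑V-pick (suc n) (y ∷ w) G = begin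
    ∑F (λ x → ∑V n (λ v → 𝟙 ((x ∷ v) ≟v (y ∷ w)) ℕ.* G (x ∷ v)))
      ≡⟨ ∑F-cong (λ x → ∑V-cong n (λ v → trans (cong (ℕ._* G (x ∷ v)) (split x v)) (ℕₚ.*-assoc (𝟙 (x ≟ y)) _ _))) ⟩
    ∑F (λ x → ∑V n (λ v → 𝟙 (x ≟ y) ℕ.* (𝟙 (v ≟v w) ℕ.* G (x ∷ v))))
      ≡⟨ ∑F-cong (λ x → ∑V-*ˡ n (𝟙 (x ≟ y)) (λ v → 𝟙 (v ≟v w) ℕ.* G (x ∷ v))) ⟩
    ∑F (λ x → 𝟙 (x ≟ y) ℕ.* ∑V n (λ v → 𝟙 (v ≟v w) ℕ.* G (x ∷ v)))
      ≡⟨ ∑F-pick y _ ⟩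
    ∑V n (λ v → 𝟙 (v ≟v w) ℕ.* G (y ∷ v))
      ≡⟨ ∑V-pick n w (λ v → G (y ∷ v)) ⟩
    G (y ∷ w) ∎
    where
    open ≡-Reasoning
    split : ∀ x v → 𝟙 ((x ∷ v) ≟v (y ∷ w)) ≡ 𝟙 (x ≟ y) ℕ.* 𝟙 (v ≟v w)
    split x v = trans (𝟙-cong ((x ∷ v) ≟v (y ∷ w)) (x ≟ y ×-dec v ≟v w)
                        Vecₚ.∷-injective (λ { (refl , refl) → refl }))
                      (𝟙-× (x ≟ y) (v ≟v w))

  ∑V-¬ : ∀ n {p} {P : Vec Carrier n → Set p} (P? : ∀ v → Dec (P v)) →
         ∑V n (λ v → 𝟙 (¬? (P? v))) ≡ q ^ n ∸ ∑V n (λ v → 𝟙 (P? v))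
  ∑V-¬ n P? = sym (begin
    q ^ n ∸ ∑V n (λ v → 𝟙 (P? v))
      ≡⟨ cong (_∸ ∑V n (λ v → 𝟙 (P? v))) (sym (trans (sym (∑V-+ n _ _))
           (trans (∑V-cong n (λ v → 𝟙-¬ (P? v))) (trans (∑V-const n 1) (ℕₚ.*-identityʳ _))))) ⟩
    ∑V n (λ v → 𝟙 (P? v)) ℕ.+ ∑V n (λ v → 𝟙 (¬? (P? v))) ∸ ∑V n (λ v → 𝟙 (P? v))
      ≡⟨ ℕₚ.m+n∸m≡n (∑V n (λ v → 𝟙 (P? v))) _ ⟩
    ∑V n (λ v → 𝟙 (¬? (P? v))) ∎) where open ≡-Reasoning

  0v : ∀ n → Vec Carrier n
  0v n = Vec.replicate n 0#

  infix 8 _·_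
  _·_ : ∀ {n} → Vec Carrier n → Vec Carrier n → Carrier
  _·_ {n} c v = ∑ n (λ j → lookup c j * lookup v j)

  ·-zeroˡ : ∀ {n} (v : Vec Carrier n) → 0v n · v ≡ 0#
  ·-zeroˡ {n} v = ∑-zero n λ j → trans (cong (_* lookup v j) (Vecₚ.lookup-replicate j 0#)) (zeroˡ _)

  ·-zeroʳ : ∀ {n} (c : Vec Carrier n) → c · 0v n ≡ 0#
  ·-zeroʳ {n} c = ∑-zero n λ j → trans (cong (lookup c j *_) (Vecₚ.lookup-replicate j 0#)) (zeroʳ _)

  nonzero-entry : ∀ {n} (v : Vec Carrier n) → v ≢ 0v n → ∃[ i ] (lookup v i ≢ 0#)
  nonzero-entry []      v≢0 = ⊥-elim (v≢0 refl)
  nonzero-entry (x ∷ v) v≢0 with x ≟ 0#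
  ... | no x≢0  = zero , x≢0
  ... | yes refl with nonzero-entry v (λ v≡0 → v≢0 (cong (0# ∷_) v≡0))
  ...   | i , vᵢ≢0 = suc i , vᵢ≢0

  entry⇒nonzero : ∀ {n} (v : Vec Carrier n) (i : Fin n) → lookup v i ≢ 0# → v ≢ 0v n
  entry⇒nonzero v i vᵢ≢0 refl = vᵢ≢0 (Vecₚ.lookup-replicate i 0#)

  fibre-count : ∀ n (c : Vec Carrier n) → c ≢ 0v n → ∀ t → ∑V n (λ v → 𝟙 (c · v ≟ t)) ≡ q ^ (n ∸ 1)
  fibre-count zero [] c≢0 t = ⊥-elim (c≢0 refl)
  fibre-count (suc n) (c₀ ∷ c) c≢0 t with c ≟v 0v n
  ... | yes refl = begin
    ∑F (λ x → ∑V n (λ v → 𝟙 (c₀ * x + 0v n · v ≟ t)))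
      ≡⟨ ∑F-cong (λ x → ∑V-cong n λ v → trans (𝟙-cong (c₀ * x + 0v n · v ≟ t) (x ≟ inv c₀ c₀≢0 * t)
           (λ e → solve-* c₀≢0 (trans (sym (+-identityʳ _)) (trans (cong (c₀ * x +_) (sym (·-zeroˡ v))) e)))
           (λ e → trans (cong (c₀ * x +_) (·-zeroˡ v)) (trans (+-identityʳ _) (unsolve-* c₀≢0 e))))
           (sym (ℕₚ.*-identityʳ _))) ⟩
    ∑F (λ x → ∑V n (λ _ → 𝟙 (x ≟ inv c₀ c₀≢0 * t) ℕ.* 1))
      ≡⟨ ∑F-cong (λ x → ∑V-*ˡ n (𝟙 (x ≟ inv c₀ c₀≢0 * t)) (λ _ → 1)) ⟩
    ∑F (λ x → 𝟙 (x ≟ inv c₀ c₀≢0 * t) ℕ.* ∑V n (λ _ → 1))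
      ≡⟨ ∑F-pick (inv c₀ c₀≢0 * t) (λ _ → ∑V n (λ _ → 1)) ⟩
    ∑V n (λ _ → 1)  ≡⟨ trans (∑V-const n 1) (ℕₚ.*-identityʳ _) ⟩
    q ^ n           ∎
    where
    open ≡-Reasoning
    c₀≢0 : c₀ ≢ 0#
    c₀≢0 c₀≡0 = c≢0 (cong (_∷ 0v n) c₀≡0)
  fibre-count (suc zero)    (c₀ ∷ []) _ t | no []≢0 = ⊥-elim ([]≢0 refl)
  fibre-count (suc (suc n)) (c₀ ∷ c)  _ t | no c≢0′ = begin
    ∑F (λ x → ∑V (suc n) (λ v → 𝟙 (c₀ * x + c · v ≟ t)))
      ≡⟨ ∑F-cong (λ x → ∑V-cong (suc n) λ v →
           𝟙-cong (c₀ * x + c · v ≟ t) (c · v ≟ - (c₀ * x) + t) subtract unsubtract) ⟩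
    ∑F (λ x → ∑V (suc n) (λ v → 𝟙 (c · v ≟ - (c₀ * x) + t)))
      ≡⟨ ∑F-cong (λ x → fibre-count (suc n) c c≢0′ (- (c₀ * x) + t)) ⟩
    ∑F (λ _ → q ^ n)  ≡⟨ ∑-const q (q ^ n) ⟩
    q ^ suc n         ∎ where open ≡-Reasoning

  nonvanishing-count : ∀ n (c : Vec Carrier n) → c ≢ 0v n →
                       ∑V n (λ v → 𝟙 (¬? (c · v ≟ 0#))) ≡ q ^ (n ∸ 1) ℕ.* (q ∸ 1)
  nonvanishing-count zero    [] c≢0 = ⊥-elim (c≢0 refl)
  nonvanishing-count (suc n) c  c≢0 = begin
    ∑V (suc n) (λ v → 𝟙 (¬? (c · v ≟ 0#)))        ≡⟨ ∑V-¬ (suc n) (λ v → c · v ≟ 0#) ⟩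
    q ^ suc n ∸ ∑V (suc n) (λ v → 𝟙 (c · v ≟ 0#)) ≡⟨ cong (q ^ suc n ∸_) (fibre-count (suc n) c c≢0 0#) ⟩
    q ℕ.* q ^ n ∸ q ^ n                          ≡⟨ cong₂ _∸_ (ℕₚ.*-comm q (q ^ n)) (sym (ℕₚ.*-identityʳ (q ^ n))) ⟩
    q ^ n ℕ.* q ∸ q ^ n ℕ.* 1                    ≡⟨ sym (ℕₚ.*-distribˡ-∸ (q ^ n) q 1) ⟩
    q ^ n ℕ.* (q ∸ 1)                            ∎ where open ≡-Reasoning

  functional-support : ∀ n (c : Vec Carrier n) →
    ∑V n (λ v → 𝟙 (¬? (c · v ≟ 0#))) ≡ 𝟙 (¬? (c ≟v 0v n)) ℕ.* (q ^ (n ∸ 1) ℕ.* (q ∸ 1))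
  functional-support n c with c ≟v 0v n
  ... | yes refl = trans (∑V-cong n (λ v → 𝟙-no (¬? (0v n · v ≟ 0#)) (λ ne → ne (·-zeroˡ v))))
                         (trans (∑V-const n 0) (ℕₚ.*-zeroʳ (q ^ n)))
  ... | no c≢0   = trans (nonvanishing-count n c c≢0) (sym (ℕₚ.+-identityʳ _))

  nonzero-count : ∀ n → ∑V n (λ v → 𝟙 (¬? (v ≟v 0v n))) ≡ q ^ n ∸ 1
  nonzero-count n = trans (∑V-¬ n (λ v → v ≟v 0v n))
    (cong (q ^ n ∸_) (trans (∑V-cong n (λ v → sym (ℕₚ.*-identityʳ _))) (∑V-pick n (0v n) (λ _ → 1))))

  ZeroPrefix : ∀ {n} → ℕ → Vec Carrier n → Set
  ZeroPrefix zero    v       = ⊤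
  ZeroPrefix (suc r) []      = ⊤
  ZeroPrefix (suc r) (x ∷ v) = x ≡ 0# × ZeroPrefix r v

  zeroPrefix? : ∀ {n} r (v : Vec Carrier n) → Dec (ZeroPrefix r v)
  zeroPrefix? zero    v       = yes tt
  zeroPrefix? (suc r) []      = yes tt
  zeroPrefix? (suc r) (x ∷ v) = x ≟ 0# ×-dec zeroPrefix? r v

  zeroPrefix⇒ : ∀ {n} r (v : Vec Carrier n) → ZeroPrefix r v → ∀ j → toℕ j < r → lookup v j ≡ 0#
  zeroPrefix⇒ (suc r) (x ∷ v) (x≡0 , _)  zero    _         = x≡0
  zeroPrefix⇒ (suc r) (x ∷ v) (_ , zp)   (suc j) (s≤s j<r) = zeroPrefix⇒ r v zp j j<r

  ⇒zeroPrefix : ∀ {n} r (v : Vec Carrier n) → (∀ j → toℕ j < r → lookup v j ≡ 0#) → ZeroPrefix r v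
  ⇒zeroPrefix zero    v       _  = tt
  ⇒zeroPrefix (suc r) []      _  = tt
  ⇒zeroPrefix (suc r) (x ∷ v) zs = zs zero (s≤s z≤n) , ⇒zeroPrefix r v (λ j j<r → zs (suc j) (s≤s j<r))

  zeroPrefix-count : ∀ n r → ∑V n (λ v → 𝟙 (zeroPrefix? r v)) ≡ q ^ (n ∸ r)
  zeroPrefix-count n       zero    = trans (∑V-const n 1) (ℕₚ.*-identityʳ _)
  zeroPrefix-count zero    (suc r) = refl
  zeroPrefix-count (suc n) (suc r) = begin
    ∑F (λ x → ∑V n (λ v → 𝟙 (x ≟ 0# ×-dec zeroPrefix? r v)))
      ≡⟨ ∑F-cong (λ x → trans (∑V-cong n (λ v → 𝟙-× (x ≟ 0#) (zeroPrefix? r v))) (∑V-*ˡ n (𝟙 (x ≟ 0#)) _)) ⟩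
    ∑F (λ x → 𝟙 (x ≟ 0#) ℕ.* ∑V n (λ v → 𝟙 (zeroPrefix? r v)))
      ≡⟨ ∑F-pick 0# (λ _ → ∑V n (λ v → 𝟙 (zeroPrefix? r v))) ⟩
    ∑V n (λ v → 𝟙 (zeroPrefix? r v)) ≡⟨ zeroPrefix-count n r ⟩
    q ^ (n ∸ r) ∎ where open ≡-Reasoning

  nonzeroPrefix-count : ∀ n r → r ≤ n → ∑V n (λ v → 𝟙 (¬? (zeroPrefix? r v))) ≡ q ^ (n ∸ r) ℕ.* (q ^ r ∸ 1)
  nonzeroPrefix-count n r r≤n = begin
    ∑V n (λ v → 𝟙 (¬? (zeroPrefix? r v)))     ≡⟨ ∑V-¬ n (zeroPrefix? r) ⟩
    q ^ n ∸ ∑V n (λ v → 𝟙 (zeroPrefix? r v))  ≡⟨ cong (q ^ n ∸_) (zeroPrefix-count n r) ⟩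
    q ^ n ∸ q ^ (n ∸ r)
      ≡⟨ cong₂ _∸_ (trans (cong (q ^_) (sym (ℕₚ.m∸n+n≡m r≤n))) (ℕₚ.^-distribˡ-+-* q (n ∸ r) r))
                   (sym (ℕₚ.*-identityʳ (q ^ (n ∸ r)))) ⟩
    q ^ (n ∸ r) ℕ.* q ^ r ∸ q ^ (n ∸ r) ℕ.* 1 ≡⟨ sym (ℕₚ.*-distribˡ-∸ (q ^ (n ∸ r)) (q ^ r) 1) ⟩
    q ^ (n ∸ r) ℕ.* (q ^ r ∸ 1)               ∎ where open ≡-Reasoning

  vec-ext : ∀ {n} {a b : Vec Carrier n} → (∀ i → lookup a i ≡ lookup b i) → a ≡ b
  vec-ext {a = a} {b} a≗b =
    trans (sym (Vecₚ.tabulate∘lookup a)) (trans (Vecₚ.tabulate-cong a≗b) (Vecₚ.tabulate∘lookup b))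

  scale : ∀ {n} → Carrier → Vec Carrier n → Vec Carrier n
  scale α w = Vec.map (α *_) w

  OnLine : ∀ {n} → Vec Carrier n → Vec Carrier n → Set
  OnLine w u = ∃[ α ] (α ≢ 0# × u ≡ scale α w)

  onLine? : ∀ {n} (w u : Vec Carrier n) → Dec (OnLine w u)
  onLine? w u = Dec.map′ (λ { (i , α≢0 , e) → to i , α≢0 , e })
    (λ { (α , α≢0 , e) → from α , (λ e′ → α≢0 (trans (sym (strictlyInverseˡ α)) e′))
                       , trans e (cong (λ β → scale β w) (sym (strictlyInverseˡ α))) })
    (Finₚ.any? (λ i → ¬? (to i ≟ 0#) ×-dec (u ≟v scale (to i) w)))

  scale-injective : ∀ {n} (w : Vec Carrier n) → w ≢ 0v n → ∀ {α β} → scale α w ≡ scale β w → α ≡ β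
  scale-injective w w≢0 {α} {β} e with nonzero-entry w w≢0
  ... | i , wᵢ≢0 = *-cancelʳ wᵢ≢0 (begin
    α * lookup w i          ≡⟨ sym (Vecₚ.lookup-map i (α *_) w) ⟩
    lookup (scale α w) i    ≡⟨ cong (λ x → lookup x i) e ⟩
    lookup (scale β w) i    ≡⟨ Vecₚ.lookup-map i (β *_) w ⟩
    β * lookup w i          ∎) where open ≡-Reasoning

  proportional : ∀ {n} (a b : Vec Carrier n) {y w} → y ≢ 0# → a ≢ 0v n →
                 (∀ i → lookup a i * y ≡ lookup b i * w) → OnLine b a
  proportional a b {y} {w} y≢0 a≢0 ay≡bw = α , α≢0 , vec-ext aᵢ≡αbᵢ
    where
    α : Carrier
    α = inv y y≢0 * w
    aᵢ≡αbᵢ : ∀ i → lookup a i ≡ lookup (scale α b) i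
    aᵢ≡αbᵢ i = begin
      lookup a i                   ≡⟨ solve-* y≢0 (trans (*-comm y _) (ay≡bw i)) ⟩
      inv y y≢0 * (lookup b i * w) ≡⟨ cong (inv y y≢0 *_) (*-comm _ w) ⟩
      inv y y≢0 * (w * lookup b i) ≡⟨ sym (*-assoc _ w _) ⟩
      α * lookup b i               ≡⟨ sym (Vecₚ.lookup-map i (α *_) b) ⟩
      lookup (scale α b) i         ∎ where open ≡-Reasoning
    α≢0 : α ≢ 0#
    α≢0 α≡0 with nonzero-entry a a≢0
    ... | i , aᵢ≢0 = aᵢ≢0 (trans (aᵢ≡αbᵢ i) (trans (Vecₚ.lookup-map i (α *_) b)
                                  (trans (cong (_* lookup b i) α≡0) (zeroˡ _))))

  ¬onLine-0 : ∀ {n} (w : Vec Carrier n) → w ≢ 0v n → ¬ OnLine w (0v n)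
  ¬onLine-0 w w≢0 (α , α≢0 , 0≡αw) with nonzero-entry w w≢0
  ... | i , wᵢ≢0 = *-≢0 α≢0 wᵢ≢0
    (trans (sym (Vecₚ.lookup-map i (α *_) w)) (trans (cong (λ x → lookup x i) (sym 0≡αw)) (Vecₚ.lookup-replicate i 0#)))

  nonzero-scalars : ∑F (λ α → 𝟙 (¬? (α ≟ 0#))) ≡ q ∸ 1
  nonzero-scalars = begin
    ∑F (λ α → 𝟙 (¬? (α ≟ 0#)))
      ≡⟨ ∑F-cong (λ α → 𝟙-cong (¬? (α ≟ 0#)) (¬? ((α ∷ []) ≟v 0v 1))
           (λ α≢0 e → α≢0 (proj₁ (Vecₚ.∷-injective e))) (λ ne α≡0 → ne (cong (_∷ []) α≡0))) ⟩
    ∑V 1 (λ v → 𝟙 (¬? (v ≟v 0v 1))) ≡⟨ nonzero-count 1 ⟩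
    q ^ 1 ∸ 1                       ≡⟨ cong (_∸ 1) (ℕₚ.*-identityʳ q) ⟩
    q ∸ 1                           ∎ where open ≡-Reasoning

  line-count : ∀ n (w : Vec Carrier n) → w ≢ 0v n → ∑V n (λ u → 𝟙 (onLine? w u)) ≡ q ∸ 1
  line-count n w w≢0 = begin
    ∑V n (λ u → 𝟙 (onLine? w u))
      ≡⟨ ∑V-cong n 𝟙-onLine ⟩
    ∑V n (λ u → ∑[ i < q ] (𝟙 (¬? (to i ≟ 0#)) ℕ.* 𝟙 (u ≟v scale (to i) w)))
      ≡⟨ ∑V-swap n q _ ⟩
    ∑[ i < q ] ∑V n (λ u → 𝟙 (¬? (to i ≟ 0#)) ℕ.* 𝟙 (u ≟v scale (to i) w))
      ≡⟨ sum-cong-≗ (λ i → trans (∑V-*ˡ n (𝟙 (¬? (to i ≟ 0#))) _) (cong (𝟙 (¬? (to i ≟ 0#)) ℕ.*_)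
           (trans (∑V-cong n (λ u → sym (ℕₚ.*-identityʳ _))) (∑V-pick n (scale (to i) w) (λ _ → 1))))) ⟩
    ∑F (λ α → 𝟙 (¬? (α ≟ 0#)) ℕ.* 1)
      ≡⟨ ∑F-cong (λ α → ℕₚ.*-identityʳ (𝟙 (¬? (α ≟ 0#)))) ⟩
    ∑F (λ α → 𝟙 (¬? (α ≟ 0#)))  ≡⟨ nonzero-scalars ⟩
    q ∸ 1                       ∎
    where
    open ≡-Reasoning
    -- u lies on the line of w for exactly one nonzero scalar, or for none.
    𝟙-onLine : ∀ u → 𝟙 (onLine? w u) ≡ ∑F (λ α → 𝟙 (¬? (α ≟ 0#)) ℕ.* 𝟙 (u ≟v scale α w))
    𝟙-onLine u with onLine? w u
    ... | yes (α₀ , α₀≢0 , refl) = sym (begin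
      ∑F (λ α → 𝟙 (¬? (α ≟ 0#)) ℕ.* 𝟙 (scale α₀ w ≟v scale α w))
        ≡⟨ ∑F-cong (λ α → trans (cong (𝟙 (¬? (α ≟ 0#)) ℕ.*_) (𝟙-cong (scale α₀ w ≟v scale α w) (α ≟ α₀)
             (λ e → sym (scale-injective w w≢0 e)) (λ e → cong (λ β → scale β w) (sym e))))
             (ℕₚ.*-comm (𝟙 (¬? (α ≟ 0#))) _)) ⟩
      ∑F (λ α → 𝟙 (α ≟ α₀) ℕ.* 𝟙 (¬? (α ≟ 0#)))  ≡⟨ ∑F-pick α₀ (λ α → 𝟙 (¬? (α ≟ 0#))) ⟩
      𝟙 (¬? (α₀ ≟ 0#))                            ≡⟨ 𝟙-yes (¬? (α₀ ≟ 0#)) α₀≢0 ⟩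
      1                                           ∎)
    ... | no ¬onLine = sym (trans (∑F-cong no-scalar) (trans (∑-const q 0) (ℕₚ.*-zeroʳ q)))
      where
      no-scalar : ∀ α → 𝟙 (¬? (α ≟ 0#)) ℕ.* 𝟙 (u ≟v scale α w) ≡ 0
      no-scalar α with α ≟ 0# | u ≟v scale α w
      ... | no α≢0 | yes e = ⊥-elim (¬onLine (α , α≢0 , e))
      ... | no _   | no _  = refl
      ... | yes _  | _     = refl

  -- Subcodes and the averaging argument.  A family b of r vectors of length n
  -- spans the subcode D = span(b); its support ‖D‖ is counted coordinatewise.

  column : ∀ {r n} → (Fin r → Fin n → Carrier) → Fin n → Vec Carrier r
  column b k = tabulate (λ t → b t k)

  lincomb-column : ∀ {r n} (b : Fin r → Fin n → Carrier) k (a : Vec Carrier r) →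
                   lincomb r (lookup a) b k ≡ column b k · a
  lincomb-column {r} b k a = ∑-cong r (λ t → trans (*-comm _ _) (cong (_* lookup a t) (sym (Vecₚ.lookup∘tabulate _ t))))

  support⇒column : ∀ {r n} (b : Fin r → Fin n → Carrier) k → ∃[ a ] (lincomb r a b k ≢ 0#) → column b k ≢ 0v r
  support⇒column {r} b k (a , lc≢0) col≡0 = lc≢0 (∑-zero r (λ t → trans (cong (a t *_)
    (trans (sym (Vecₚ.lookup∘tabulate (λ t → b t k) t)) (trans (cong (λ x → lookup x t) col≡0) (Vecₚ.lookup-replicate t 0#))))
    (zeroʳ _)))

  column⇒support : ∀ {r n} (b : Fin r → Fin n → Carrier) k → column b k ≢ 0v r → ∃[ a ] (lincomb r a b k ≢ 0#)
  column⇒support {r} b k col≢0 with nonzero-entry (column b k) col≢0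
  ... | t , bₜₖ≢0 = (λ s → δ s t) , λ e → bₜₖ≢0 (trans (Vecₚ.lookup∘tabulate (λ t → b t k) t) (trans (sym (∑-δ r t (λ s → b s k))) e))

  inSupport? : ∀ {r n} (b : Fin r → Fin n → Carrier) k → Dec (∃[ a ] (lincomb r a b k ≢ 0#))
  inSupport? b k = Dec.map′ (column⇒support b k) (support⇒column b k) (¬? (column b k ≟v 0v _))

  supportSize : ∀ {r n} → (Fin r → Fin n → Carrier) → ℕ
  supportSize {n = n} b = ∑[ k < n ] 𝟙 (inSupport? b k)

  weight-sum : ∀ {n} r (b : Fin r → Fin n → Carrier) →
    ∑V r (λ a → ∑[ k < n ] 𝟙 (¬? (lincomb r (lookup a) b k ≟ 0#))) ≡ supportSize b ℕ.* (q ^ (r ∸ 1) ℕ.* (q ∸ 1))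
  weight-sum {n} r b = begin
    ∑V r (λ a → ∑[ k < n ] 𝟙 (¬? (lincomb r (lookup a) b k ≟ 0#)))   ≡⟨ ∑V-swap r n _ ⟩
    ∑[ k < n ] ∑V r (λ a → 𝟙 (¬? (lincomb r (lookup a) b k ≟ 0#)))
      ≡⟨ sum-cong-≗ (λ k → begin
           ∑V r (λ a → 𝟙 (¬? (lincomb r (lookup a) b k ≟ 0#)))
             ≡⟨ ∑V-cong r (λ a → 𝟙-cong (¬? (lincomb r (lookup a) b k ≟ 0#)) (¬? (column b k · a ≟ 0#))
                  (λ ne e → ne (trans (lincomb-column b k a) e)) (λ ne e → ne (trans (sym (lincomb-column b k a)) e))) ⟩
           ∑V r (λ a → 𝟙 (¬? (column b k · a ≟ 0#)))                       ≡⟨ functional-support r (column b k) ⟩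
           𝟙 (¬? (column b k ≟v 0v r)) ℕ.* (q ^ (r ∸ 1) ℕ.* (q ∸ 1))
             ≡⟨ cong (ℕ._* _) (𝟙-cong (¬? (column b k ≟v 0v r)) (inSupport? b k) (column⇒support b k) (support⇒column b k)) ⟩
           𝟙 (inSupport? b k) ℕ.* (q ^ (r ∸ 1) ℕ.* (q ∸ 1)) ∎) ⟩
    ∑[ k < n ] (𝟙 (inSupport? b k) ℕ.* (q ^ (r ∸ 1) ℕ.* (q ∸ 1)))
      ≡⟨ sym (*-distribʳ-sum _ (λ k → 𝟙 (inSupport? b k))) ⟩
    supportSize b ℕ.* (q ^ (r ∸ 1) ℕ.* (q ∸ 1))  ∎ where open ≡-Reasoning

  averaging-bound : ∀ {n} r (b : Fin r → Fin n → Carrier) W →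
    (∀ a → (∀ k → lincomb r a b k ≡ 0#) → ∀ t → a t ≡ 0#) →
    (∀ a k → lincomb r a b k ≢ 0# → W ≤ ∑[ k < n ] 𝟙 (¬? (lincomb r a b k ≟ 0#))) →
    (q ^ r ∸ 1) ℕ.* W ≤ supportSize b ℕ.* (q ^ (r ∸ 1) ℕ.* (q ∸ 1))
  averaging-bound {n} r b W independent weight≥W = begin
    (q ^ r ∸ 1) ℕ.* W                                      ≡⟨ cong (ℕ._* W) (sym (nonzero-count r)) ⟩
    ∑V r (λ a → 𝟙 (¬? (a ≟v 0v r))) ℕ.* W                   ≡⟨ sym (∑V-*ʳ r W _) ⟩
    ∑V r (λ a → 𝟙 (¬? (a ≟v 0v r)) ℕ.* W)                   ≤⟨ ∑V-mono r (λ a → nonzero⇒W≤ a (a ≟v 0v r)) ⟩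
    ∑V r (λ a → ∑[ k < n ] 𝟙 (¬? (lincomb r (lookup a) b k ≟ 0#)))  ≡⟨ weight-sum r b ⟩
    supportSize b ℕ.* (q ^ (r ∸ 1) ℕ.* (q ∸ 1))            ∎
    where
    open ℕₚ.≤-Reasoning
    nonzero⇒W≤ : ∀ a (d : Dec (a ≡ 0v r)) → 𝟙 (¬? d) ℕ.* W ≤ ∑[ k < n ] 𝟙 (¬? (lincomb r (lookup a) b k ≟ 0#))
    nonzero⇒W≤ a (yes _) = z≤n
    nonzero⇒W≤ a (no a≢0) with Finₚ.any? (λ k → ¬? (lincomb r (lookup a) b k ≟ 0#))
    ... | yes (k , lc≢0) = subst (_≤ _) (sym (ℕₚ.*-identityˡ W)) (weight≥W (lookup a) k lc≢0)
    ... | no none = ⊥-elim (a≢0 (vec-ext λ t → trans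
          (independent (lookup a) (λ k → Dec.decidable-stable (lincomb r (lookup a) b k ≟ 0#) (λ ne → none (k , ne))) t)
          (sym (Vecₚ.lookup-replicate t 0#))))

  -- Matrices and linear forms.

  outer : ∀ {ℓ m} → Vec Carrier ℓ → Vec Carrier m → Mat ℓ m
  outer u v i j = lookup u i * lookup v j

  -- uᵀ f ∈ Fᵐ, the vector of the functional v ↦ f(u vᵀ).
  rowComb : ∀ {ℓ m} → LinForm ℓ m → Vec Carrier ℓ → Vec Carrier m
  rowComb {ℓ} f u = tabulate (λ j → ∑ ℓ (λ i → f i j * lookup u i))

  eval-outer : ∀ {ℓ m} (f : LinForm ℓ m) u v → eval f (outer u v) ≡ rowComb f u · v
  eval-outer {ℓ} {m} f u v = begin
    ∑ ℓ (λ i → ∑ m (λ j → f i j * (lookup u i * lookup v j)))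
      ≡⟨ ∑-cong ℓ (λ i → ∑-cong m (λ j → trans (sym (*-assoc _ _ _)) (cong (_* lookup v j) (*-comm _ _)))) ⟩
    ∑ ℓ (λ i → ∑ m (λ j → (lookup u i * f i j) * lookup v j))
      ≡⟨ ∑-swap ℓ m _ ⟩
    ∑ m (λ j → ∑ ℓ (λ i → (lookup u i * f i j) * lookup v j))
      ≡⟨ ∑-cong m (λ j → trans (∑-*ʳ ℓ (lookup v j) _) (cong (_* lookup v j)
           (trans (∑-cong ℓ (λ i → *-comm _ _)) (sym (Vecₚ.lookup∘tabulate _ j))))) ⟩
    rowComb f u · v ∎ where open ≡-Reasoning

  rowComb-zero : ∀ {ℓ m} (f : LinForm ℓ m) → rowComb f (0v ℓ) ≡ 0v m
  rowComb-zero {ℓ} f = vec-ext λ j → trans (Vecₚ.lookup∘tabulate _ j) (trans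
    (∑-zero ℓ (λ i → trans (cong (f i j *_) (Vecₚ.lookup-replicate i 0#)) (zeroʳ _)))
    (sym (Vecₚ.lookup-replicate j 0#)))

  eval-cong : ∀ {ℓ m} (f : LinForm ℓ m) {M N : Mat ℓ m} → (∀ i j → M i j ≡ N i j) → eval f M ≡ eval f N
  eval-cong {ℓ} {m} f M≗N = ∑-cong ℓ (λ i → ∑-cong m (λ j → cong (f i j *_) (M≗N i j)))

  eval-scale : ∀ {ℓ m} (f : LinForm ℓ m) c (N : Mat ℓ m) → eval f (λ i j → c * N i j) ≡ c * eval f N
  eval-scale {ℓ} {m} f c N = trans (∑-cong ℓ (λ i → trans (∑-cong m (λ j → x∙yz≈y∙xz (f i j) c (N i j)))
    (∑-*ˡ m c (λ j → f i j * N i j)))) (∑-*ˡ ℓ c _)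

  eval-linear : ∀ {ℓ m} r (a : Fin r → Carrier) (f : Fin r → LinForm ℓ m) N →
                eval (λ i j → ∑ r (λ t → a t * f t i j)) N ≡ ∑ r (λ t → a t * eval (f t) N)
  eval-linear {ℓ} {m} r a f N = begin
    ∑ ℓ (λ i → ∑ m (λ j → ∑ r (λ t → a t * f t i j) * N i j))
      ≡⟨ ∑-cong ℓ (λ i → ∑-cong m (λ j → sym (∑-*ʳ r (N i j) (λ t → a t * f t i j)))) ⟩
    ∑ ℓ (λ i → ∑ m (λ j → ∑ r (λ t → a t * f t i j * N i j)))
      ≡⟨ ∑-cong ℓ (λ i → ∑-swap m r _) ⟩
    ∑ ℓ (λ i → ∑ r (λ t → ∑ m (λ j → a t * f t i j * N i j)))
      ≡⟨ ∑-swap ℓ r _ ⟩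
    ∑ r (λ t → ∑ ℓ (λ i → ∑ m (λ j → a t * f t i j * N i j)))
      ≡⟨ ∑-cong r (λ t → trans (∑-cong ℓ (λ i → trans (∑-cong m (λ j → *-assoc (a t) _ _))
           (∑-*ˡ m (a t) _))) (∑-*ˡ ℓ (a t) _)) ⟩
    ∑ r (λ t → a t * eval (f t) N) ∎ where open ≡-Reasoning

  sm-sym : ∀ {ℓ m} {M N : Mat ℓ m} → ScalarMultiple M N → ScalarMultiple N M
  sm-sym (c , c≢0 , M≡cN) = inv c c≢0 , ≢0-factorʳ {c} (λ e → 1≢0 (trans (sym (inv-r c c≢0)) e)) ,
    λ i j → solve-* c≢0 (sym (M≡cN i j))

  sm-trans : ∀ {ℓ m} {M N P : Mat ℓ m} → ScalarMultiple M N → ScalarMultiple N P → ScalarMultiple M P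
  sm-trans (c , c≢0 , M≡cN) (d , d≢0 , N≡dP) = c * d , *-≢0 c≢0 d≢0 ,
    λ i j → trans (M≡cN i j) (trans (cong (c *_) (N≡dP i j)) (sym (*-assoc c d _)))

  eval≢0-invariant : ∀ {ℓ m} (f : LinForm ℓ m) {M N : Mat ℓ m} → ScalarMultiple M N → eval f N ≢ 0# → eval f M ≢ 0#
  eval≢0-invariant f {M} {N} (c , c≢0 , M≡cN) fN≢0 fM≡0 =
    *-≢0 c≢0 fN≢0 (trans (sym (eval-scale f c N)) (trans (sym (eval-cong f M≡cN)) fM≡0))

  outer-rank1 : ∀ {ℓ m} {u : Vec Carrier ℓ} {v : Vec Carrier m} → u ≢ 0v ℓ → v ≢ 0v m → IsRank1 (outer u v)
  outer-rank1 {u = u} {v} u≢0 v≢0 with nonzero-entry u u≢0 | nonzero-entry v v≢0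
  ... | i , uᵢ≢0 | j , vⱼ≢0 = (i , j , *-≢0 uᵢ≢0 vⱼ≢0) , lookup u , lookup v , (λ _ _ → refl)

  outer-lines : ∀ {ℓ m} {u u₀ : Vec Carrier ℓ} {v v₀ : Vec Carrier m} → u ≢ 0v ℓ → v ≢ 0v m →
                ScalarMultiple (outer u v) (outer u₀ v₀) → OnLine u₀ u × OnLine v₀ v
  outer-lines {u = u} {u₀} {v} {v₀} u≢0 v≢0 (c , _ , uv≡cu₀v₀)
    with nonzero-entry u u≢0 | nonzero-entry v v≢0
  ... | i₁ , uᵢ₁≢0 | j₁ , vⱼ₁≢0 =
    proportional u u₀ vⱼ₁≢0 u≢0 (λ i → trans (uv≡cu₀v₀ i j₁) (x∙yz≈y∙xz c _ _)) ,
    proportional v v₀ uᵢ₁≢0 v≢0 (λ j → trans (*-comm _ _) (trans (uv≡cu₀v₀ i₁ j)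
      (trans (cong (c *_) (*-comm _ _)) (x∙yz≈y∙xz c _ _))))

  lines-outer : ∀ {ℓ m} {u u₀ : Vec Carrier ℓ} {v v₀ : Vec Carrier m} →
                OnLine u₀ u → OnLine v₀ v → ScalarMultiple (outer u v) (outer u₀ v₀)
  lines-outer {u₀ = u₀} {v₀ = v₀} (α , α≢0 , refl) (β , β≢0 , refl) = α * β , *-≢0 α≢0 β≢0 , λ i j →
    trans (cong₂ _*_ (Vecₚ.lookup-map i (α *_) u₀) (Vecₚ.lookup-map j (β *_) v₀)) (interchange α _ β _)

  module Representatives {ℓ m n̂} (M̂ : Fin n̂ → Mat ℓ m) (reps : IsProjReps M̂) where

    u₀ : Fin n̂ → Vec Carrier ℓ
    u₀ k = tabulate (proj₁ (proj₂ (proj₁ reps k)))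

    v₀ : Fin n̂ → Vec Carrier m
    v₀ k = tabulate (proj₁ (proj₂ (proj₂ (proj₁ reps k))))

    M̂≡u₀v₀ : ∀ k i j → M̂ k i j ≡ outer (u₀ k) (v₀ k) i j
    M̂≡u₀v₀ k i j = trans (proj₂ (proj₂ (proj₂ (proj₁ reps k))) i j)
      (sym (cong₂ _*_ (Vecₚ.lookup∘tabulate _ i) (Vecₚ.lookup∘tabulate _ j)))

    u₀v₀-entry≢0 : ∀ k → ∃[ i ] ∃[ j ] (lookup (u₀ k) i * lookup (v₀ k) j ≢ 0#)
    u₀v₀-entry≢0 k with proj₁ (proj₁ reps k)
    ... | i , j , M̂ᵢⱼ≢0 = i , j , λ e → M̂ᵢⱼ≢0 (trans (M̂≡u₀v₀ k i j) e)

    u₀≢0 : ∀ k → u₀ k ≢ 0v ℓ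
    u₀≢0 k with u₀v₀-entry≢0 k
    ... | i , _ , uv≢0 = entry⇒nonzero (u₀ k) i (≢0-factorˡ uv≢0)

    v₀≢0 : ∀ k → v₀ k ≢ 0v m
    v₀≢0 k with u₀v₀-entry≢0 k
    ... | _ , j , uv≢0 = entry⇒nonzero (v₀ k) j (≢0-factorʳ uv≢0)

    class : ∀ {u v} → u ≢ 0v ℓ → v ≢ 0v m → Fin n̂
    class u≢0 v≢0 = proj₁ (proj₁ (proj₂ reps) _ (outer-rank1 u≢0 v≢0))

    class-sm : ∀ {u v} (u≢0 : u ≢ 0v ℓ) (v≢0 : v ≢ 0v m) → ScalarMultiple (outer u v) (M̂ (class u≢0 v≢0))
    class-sm u≢0 v≢0 = proj₂ (proj₁ (proj₂ reps) _ (outer-rank1 u≢0 v≢0))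

    representative : ∀ {u v} → u ≢ 0v ℓ → v ≢ 0v m →
                     ∃[ k ] ∃[ c ] (c ≢ 0# × (∀ i j → M̂ k i j ≡ c * outer u v i j))
    representative u≢0 v≢0 = class u≢0 v≢0 , sm-sym (class-sm u≢0 v≢0)

    class⇒lines : ∀ {u v} (u≢0 : u ≢ 0v ℓ) (v≢0 : v ≢ 0v m) k → k ≡ class u≢0 v≢0 →
                  OnLine (u₀ k) u × OnLine (v₀ k) v
    class⇒lines u≢0 v≢0 k refl with class-sm u≢0 v≢0
    ... | c , c≢0 , uv≡cM̂ = outer-lines u≢0 v≢0 (c , c≢0 , λ i j → trans (uv≡cM̂ i j) (cong (c *_) (M̂≡u₀v₀ k i j)))

    lines⇒class : ∀ {u v} (u≢0 : u ≢ 0v ℓ) (v≢0 : v ≢ 0v m) k →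
                  OnLine (u₀ k) u → OnLine (v₀ k) v → k ≡ class u≢0 v≢0
    lines⇒class u≢0 v≢0 k u∈ v∈ with lines-outer u∈ v∈
    ... | c , c≢0 , uv≡cu₀v₀ = proj₂ (proj₂ reps) k (class u≢0 v≢0)
      (sm-trans (sm-sym (c , c≢0 , λ i j → trans (uv≡cu₀v₀ i j) (cong (c *_) (sym (M̂≡u₀v₀ k i j)))))
                (class-sm u≢0 v≢0))

    -- Orbit counting: for a property P of matrices invariant under nonzero scalars,
    -- each representative satisfying P accounts for exactly (q - 1)² pairs (u, v).
    module _ {P : Mat ℓ m → Set} (P? : ∀ M → Dec (P M))
             (P-invariant : ∀ {M N} → ScalarMultiple M N → P N → P M) where

      pair-decomposition : ∀ u v →
        𝟙 (¬? (u ≟v 0v ℓ)) ℕ.* 𝟙 (¬? (v ≟v 0v m)) ℕ.* 𝟙 (P? (outer u v))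
        ≡ ∑[ k < n̂ ] (𝟙 (onLine? (u₀ k) u) ℕ.* 𝟙 (onLine? (v₀ k) v) ℕ.* 𝟙 (P? (M̂ k)))
      pair-decomposition u v with u ≟v 0v ℓ | v ≟v 0v m
      ... | yes refl | _ = sym (trans (sum-cong-≗ λ k →
              cong (λ x → x ℕ.* 𝟙 (onLine? (v₀ k) v) ℕ.* 𝟙 (P? (M̂ k))) (𝟙-no (onLine? (u₀ k) (0v ℓ)) (¬onLine-0 (u₀ k) (u₀≢0 k))))
            (sum-replicate-zero n̂))
      ... | no _ | yes refl = sym (trans (sum-cong-≗ λ k →
              trans (cong (λ x → 𝟙 (onLine? (u₀ k) u) ℕ.* x ℕ.* 𝟙 (P? (M̂ k)))
                          (𝟙-no (onLine? (v₀ k) (0v m)) (¬onLine-0 (v₀ k) (v₀≢0 k))))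
                    (cong (ℕ._* 𝟙 (P? (M̂ k))) (ℕₚ.*-zeroʳ (𝟙 (onLine? (u₀ k) u)))))
            (sum-replicate-zero n̂))
      ... | no u≢0 | no v≢0 = begin
        1 ℕ.* 1 ℕ.* 𝟙 (P? (outer u v))   ≡⟨ ℕₚ.*-identityˡ _ ⟩
        𝟙 (P? (outer u v))
          ≡⟨ 𝟙-cong (P? (outer u v)) (P? (M̂ κ)) (P-invariant (sm-sym (class-sm u≢0 v≢0))) (P-invariant (class-sm u≢0 v≢0)) ⟩
        𝟙 (P? (M̂ κ))                      ≡⟨ sym (∑-pick n̂ κ (λ k → 𝟙 (P? (M̂ k)))) ⟩
        ∑[ k < n̂ ] (𝟙 (k Finₚ.≟ κ) ℕ.* 𝟙 (P? (M̂ k)))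
          ≡⟨ sum-cong-≗ (λ k → cong (ℕ._* 𝟙 (P? (M̂ k))) (trans
               (𝟙-cong (k Finₚ.≟ κ) (onLine? (u₀ k) u ×-dec onLine? (v₀ k) v)
                 (class⇒lines u≢0 v≢0 k) (λ (u∈ , v∈) → lines⇒class u≢0 v≢0 k u∈ v∈))
               (𝟙-× (onLine? (u₀ k) u) (onLine? (v₀ k) v)))) ⟩
        ∑[ k < n̂ ] (𝟙 (onLine? (u₀ k) u) ℕ.* 𝟙 (onLine? (v₀ k) v) ℕ.* 𝟙 (P? (M̂ k))) ∎
        where
        open ≡-Reasoning
        κ : Fin n̂
        κ = class u≢0 v≢0

      orbit-count :
        ∑V ℓ (λ u → ∑V m (λ v → 𝟙 (¬? (u ≟v 0v ℓ)) ℕ.* 𝟙 (¬? (v ≟v 0v m)) ℕ.* 𝟙 (P? (outer u v))))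
        ≡ ∑[ k < n̂ ] 𝟙 (P? (M̂ k)) ℕ.* ((q ∸ 1) ℕ.* (q ∸ 1))
      orbit-count = begin
        ∑V ℓ (λ u → ∑V m (λ v → 𝟙 (¬? (u ≟v 0v ℓ)) ℕ.* 𝟙 (¬? (v ≟v 0v m)) ℕ.* 𝟙 (P? (outer u v))))
          ≡⟨ ∑V-cong ℓ (λ u → trans (∑V-cong m (pair-decomposition u)) (∑V-swap m n̂ _)) ⟩
        ∑V ℓ (λ u → ∑[ k < n̂ ] ∑V m (λ v → L k u v))  ≡⟨ ∑V-swap ℓ n̂ _ ⟩
        ∑[ k < n̂ ] ∑V ℓ (λ u → ∑V m (λ v → L k u v))
          ≡⟨ sum-cong-≗ (λ k → begin
               ∑V ℓ (λ u → ∑V m (λ v → L k u v))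
                 ≡⟨ trans (∑V-cong ℓ (λ u → ∑V-*ʳ m (𝟙 (P? (M̂ k))) _)) (∑V-*ʳ ℓ (𝟙 (P? (M̂ k))) _) ⟩
               ∑V ℓ (λ u → ∑V m (λ v → 𝟙 (onLine? (u₀ k) u) ℕ.* 𝟙 (onLine? (v₀ k) v))) ℕ.* 𝟙 (P? (M̂ k))
                 ≡⟨ cong (ℕ._* 𝟙 (P? (M̂ k))) (trans (∑V-product ℓ m _ _)
                      (cong₂ ℕ._*_ (line-count ℓ (u₀ k) (u₀≢0 k)) (line-count m (v₀ k) (v₀≢0 k)))) ⟩
               (q ∸ 1) ℕ.* (q ∸ 1) ℕ.* 𝟙 (P? (M̂ k))
                 ≡⟨ ℕₚ.*-comm ((q ∸ 1) ℕ.* (q ∸ 1)) _ ⟩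
               𝟙 (P? (M̂ k)) ℕ.* ((q ∸ 1) ℕ.* (q ∸ 1)) ∎) ⟩
        ∑[ k < n̂ ] (𝟙 (P? (M̂ k)) ℕ.* ((q ∸ 1) ℕ.* (q ∸ 1)))
          ≡⟨ sym (*-distribʳ-sum ((q ∸ 1) ℕ.* (q ∸ 1)) (λ k → 𝟙 (P? (M̂ k)))) ⟩
        ∑[ k < n̂ ] 𝟙 (P? (M̂ k)) ℕ.* ((q ∸ 1) ℕ.* (q ∸ 1)) ∎
        where
        open ≡-Reasoning
        L : Fin n̂ → Vec Carrier ℓ → Vec Carrier m → ℕ
        L k u v = 𝟙 (onLine? (u₀ k) u) ℕ.* 𝟙 (onLine? (v₀ k) v) ℕ.* 𝟙 (P? (M̂ k))

    weight : LinForm ℓ m → ℕ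
    weight f = ∑[ k < n̂ ] 𝟙 (¬? (eval f (M̂ k) ≟ 0#))

    eval≢0? : ∀ (f : LinForm ℓ m) M → Dec (eval f M ≢ 0#)
    eval≢0? f M = ¬? (eval f M ≟ 0#)

    -- For fixed u ≠ 0, f(u vᵀ) = (uᵀ f) · v is a linear functional of v.
    weight-over-u : ∀ (f : LinForm ℓ m) u →
      ∑V m (λ v → 𝟙 (¬? (u ≟v 0v ℓ)) ℕ.* 𝟙 (¬? (v ≟v 0v m)) ℕ.* 𝟙 (eval≢0? f (outer u v)))
      ≡ 𝟙 (¬? (rowComb f u ≟v 0v m)) ℕ.* (q ^ (m ∸ 1) ℕ.* (q ∸ 1))
    weight-over-u f u with u ≟v 0v ℓ
    ... | yes refl = trans (trans (∑V-const m 0) (ℕₚ.*-zeroʳ (q ^ m)))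
                           (sym (cong (ℕ._* _) (𝟙-no (¬? (rowComb f (0v ℓ) ≟v 0v m)) (λ ne → ne (rowComb-zero f)))))
    ... | no _ = trans (∑V-cong m term) (functional-support m (rowComb f u))
      where
      term : ∀ v → 1 ℕ.* 𝟙 (¬? (v ≟v 0v m)) ℕ.* 𝟙 (eval≢0? f (outer u v)) ≡ 𝟙 (¬? (rowComb f u · v ≟ 0#))
      term v with v ≟v 0v m
      ... | yes refl = sym (𝟙-no (¬? (rowComb f u · 0v m ≟ 0#)) (λ ne → ne (·-zeroʳ (rowComb f u))))
      ... | no _ = trans (ℕₚ.+-identityʳ _) (𝟙-cong (eval≢0? f (outer u v)) (¬? (rowComb f u · v ≟ 0#))
                     (λ ne e → ne (trans (eval-outer f u v) e)) (λ ne e → ne (trans (sym (eval-outer f u v)) e)))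

    weight-formula : ∀ (f : LinForm ℓ m) →
      weight f ℕ.* ((q ∸ 1) ℕ.* (q ∸ 1)) ≡ ∑V ℓ (λ u → 𝟙 (¬? (rowComb f u ≟v 0v m))) ℕ.* (q ^ (m ∸ 1) ℕ.* (q ∸ 1))
    weight-formula f = begin
      weight f ℕ.* ((q ∸ 1) ℕ.* (q ∸ 1))
        ≡⟨ sym (orbit-count (eval≢0? f) (eval≢0-invariant f)) ⟩
      ∑V ℓ (λ u → ∑V m (λ v → 𝟙 (¬? (u ≟v 0v ℓ)) ℕ.* 𝟙 (¬? (v ≟v 0v m)) ℕ.* 𝟙 (eval≢0? f (outer u v))))
        ≡⟨ ∑V-cong ℓ (weight-over-u f) ⟩
      ∑V ℓ (λ u → 𝟙 (¬? (rowComb f u ≟v 0v m)) ℕ.* (q ^ (m ∸ 1) ℕ.* (q ∸ 1)))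
        ≡⟨ ∑V-*ʳ ℓ _ _ ⟩
      ∑V ℓ (λ u → 𝟙 (¬? (rowComb f u ≟v 0v m))) ℕ.* (q ^ (m ∸ 1) ℕ.* (q ∸ 1)) ∎ where open ≡-Reasoning

    nonzero-coefficient : ∀ (f : LinForm ℓ m) N → eval f N ≢ 0# → ∃[ i ] ∃[ j ] (f i j ≢ 0#)
    nonzero-coefficient f N fN≢0 with Finₚ.any? (λ i → Finₚ.any? (λ j → ¬? (f i j ≟ 0#)))
    ... | yes found = found
    ... | no none = ⊥-elim (fN≢0 (∑-zero ℓ (λ i → ∑-zero m (λ j →
            trans (cong (_* N i j) (Dec.decidable-stable (f i j ≟ 0#) (λ fᵢⱼ≢0 → none (i , j , fᵢⱼ≢0)))) (zeroˡ _)))))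

    min-weight : ∀ (f : LinForm ℓ m) k → eval f (M̂ k) ≢ 0# → q ^ (ℓ ∸ 1) ℕ.* q ^ (m ∸ 1) ≤ weight f
    min-weight f k fM̂ₖ≢0 with nonzero-coefficient f (M̂ k) fM̂ₖ≢0
    ... | i , j , fᵢⱼ≢0 = ℕₚ.*-cancelʳ-≤ _ _ ((q ∸ 1) ℕ.* (q ∸ 1)) {{q∸1²≢0}} (begin
      q ^ (ℓ ∸ 1) ℕ.* q ^ (m ∸ 1) ℕ.* ((q ∸ 1) ℕ.* (q ∸ 1))
        ≡⟨ ℕ-interchange (q ^ (ℓ ∸ 1)) _ _ _ ⟩
      q ^ (ℓ ∸ 1) ℕ.* (q ∸ 1) ℕ.* (q ^ (m ∸ 1) ℕ.* (q ∸ 1))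
        ≡⟨ cong (ℕ._* _) (sym (nonvanishing-count ℓ col col≢0)) ⟩
      ∑V ℓ (λ u → 𝟙 (¬? (col · u ≟ 0#))) ℕ.* (q ^ (m ∸ 1) ℕ.* (q ∸ 1))
        ≤⟨ ℕₚ.*-monoˡ-≤ _ (∑V-mono ℓ col·u≢0⇒uᵀf≢0) ⟩
      ∑V ℓ (λ u → 𝟙 (¬? (rowComb f u ≟v 0v m))) ℕ.* (q ^ (m ∸ 1) ℕ.* (q ∸ 1))
        ≡⟨ sym (weight-formula f) ⟩
      weight f ℕ.* ((q ∸ 1) ℕ.* (q ∸ 1)) ∎)
      where
      open ℕₚ.≤-Reasoning
      -- the j-th column of f; the j-th entry of uᵀ f is col · u
      col : Vec Carrier ℓ
      col = tabulate (λ i → f i j)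
      col≢0 : col ≢ 0v ℓ
      col≢0 = entry⇒nonzero col i (λ e → fᵢⱼ≢0 (trans (sym (Vecₚ.lookup∘tabulate _ i)) e))
      entry-j : ∀ u → lookup (rowComb f u) j ≡ col · u
      entry-j u = trans (Vecₚ.lookup∘tabulate _ j)
        (∑-cong ℓ (λ i → cong (_* lookup u i) (sym (Vecₚ.lookup∘tabulate (λ i → f i j) i))))
      col·u≢0⇒uᵀf≢0 : ∀ u → 𝟙 (¬? (col · u ≟ 0#)) ≤ 𝟙 (¬? (rowComb f u ≟v 0v m))
      col·u≢0⇒uᵀf≢0 u with col · u ≟ 0# | rowComb f u ≟v 0v m
      ... | yes _ | _ = z≤n
      ... | no _ | no _ = ℕₚ.≤-refl
      ... | no ne | yes e = ⊥-elim (ne (trans (sym (entry-j u)) (trans (cong (λ x → lookup x j) e) (Vecₚ.lookup-replicate j 0#))))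

    support-lower-bound : ∀ r b s → IsSubcodeBasis (Cdet M̂) r b → SupportWeight r b s →
      (q ^ r ∸ 1) ℕ.* (q ^ (ℓ ∸ 1) ℕ.* q ^ (m ∸ 1)) ≤ s ℕ.* (q ^ (r ∸ 1) ℕ.* (q ∸ 1))
    support-lower-bound r b s (b∈C , independent) ‖D‖≡s =
      subst (λ x → _ ≤ x ℕ.* _) (sym (Count⇒∑ (inSupport? b) ‖D‖≡s))
            (averaging-bound r b _ independent combination-weight)
      where
      -- b t = ĉ_(f t), so the combination with coefficients a is ĉ_g for g = Σ a_t f_t
      f : Fin r → LinForm ℓ m
      f t = proj₁ (b∈C t)
      combination-weight : ∀ a k → lincomb r a b k ≢ 0# →
        q ^ (ℓ ∸ 1) ℕ.* q ^ (m ∸ 1) ≤ ∑[ k < n̂ ] 𝟙 (¬? (lincomb r a b k ≟ 0#))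
      combination-weight a k lc≢0 = subst (_ ≤_) (sym (sum-cong-≗ λ k′ →
          𝟙-cong (¬? (lincomb r a b k′ ≟ 0#)) (eval≢0? g (M̂ k′))
            (λ ne e → ne (trans (lc≡ĉ_g k′) e)) (λ ne e → ne (trans (sym (lc≡ĉ_g k′)) e))))
        (min-weight g k (λ e → lc≢0 (trans (lc≡ĉ_g k) e)))
        where
        g : LinForm ℓ m
        g i j = ∑ r (λ t → a t * f t i j)
        lc≡ĉ_g : ∀ k → lincomb r a b k ≡ eval g (M̂ k)
        lc≡ĉ_g k = trans (∑-cong r (λ t → cong (a t *_) (proj₂ (b∈C t) k))) (sym (eval-linear r a f (M̂ k)))

    -- An explicit subcode attaining the bound: for a row i₀ and r ≤ m, the codewords
    -- of the forms X_(i₀,t), t < r, whose support is {k : M̂ k has a nonzero entry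
    -- among the first r of row i₀}.
    module ExplicitSubcode (i₀ : Fin ℓ) (r : ℕ) (r≤m : r ≤ m) where

      col : Fin r → Fin m
      col t = Fin.inject≤ t r≤m

      col<r : ∀ t → toℕ (col t) < r
      col<r t = subst (_< r) (sym (Finₚ.toℕ-inject≤ t r≤m)) (Finₚ.toℕ<n t)

      X : Fin r → LinForm ℓ m
      X t i j = δ i i₀ * δ j (col t)

      eval-X : ∀ t N → eval (X t) N ≡ N i₀ (col t)
      eval-X t N = begin
        ∑ ℓ (λ i → ∑ m (λ j → δ i i₀ * δ j (col t) * N i j))
          ≡⟨ ∑-cong ℓ (λ i → trans (∑-cong m (λ j → *-assoc (δ i i₀) _ _)) (∑-*ˡ m (δ i i₀) _)) ⟩
        ∑ ℓ (λ i → δ i i₀ * ∑ m (λ j → δ j (col t) * N i j))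
          ≡⟨ ∑-cong ℓ (λ i → cong (δ i i₀ *_) (∑-δ m (col t) (N i))) ⟩
        ∑ ℓ (λ i → δ i i₀ * N i (col t))  ≡⟨ ∑-δ ℓ i₀ (λ i → N i (col t)) ⟩
        N i₀ (col t)                      ∎ where open ≡-Reasoning

      b : Fin r → Fin n̂ → Carrier
      b t = codeword M̂ (X t)

      e : ∀ {n} → Fin n → Vec Carrier n
      e i = tabulate (λ j → δ j i)

      e≢0 : ∀ {n} (i : Fin n) → e i ≢ 0v n
      e≢0 i = entry⇒nonzero (e i) i (λ e≡0 → 1≢0 (trans (sym (δ-same i)) (trans (sym (Vecₚ.lookup∘tabulate _ i)) e≡0)))

      e·u : ∀ {n} (i : Fin n) u → e i · u ≡ lookup u i
      e·u {n} i u = trans (∑-cong n (λ j → cong (_* lookup u j) (Vecₚ.lookup∘tabulate _ j))) (∑-δ n i (lookup u))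

      lincomb-at-unit : ∀ a s κ c → (∀ i j → M̂ κ i j ≡ c * outer (e i₀) (e (col s)) i j) →
                        lincomb r a b κ ≡ a s * c
      lincomb-at-unit a s κ c M̂≡cuv = begin
        ∑ r (λ t → a t * eval (X t) (M̂ κ))
          ≡⟨ ∑-cong r (λ t → cong (a t *_) (trans (eval-X t (M̂ κ)) (M̂≡cuv i₀ (col t)))) ⟩
        ∑ r (λ t → a t * (c * (lookup (e i₀) i₀ * lookup (e (col s)) (col t))))
          ≡⟨ ∑-cong r (λ t → cong (λ x → a t * (c * x)) (trans
               (cong₂ _*_ (trans (Vecₚ.lookup∘tabulate (λ j → δ j i₀) i₀) (δ-same i₀))
                          (trans (Vecₚ.lookup∘tabulate (λ j → δ j (col s)) (col t)) (δ-injective col (Finₚ.inject≤-injective r≤m r≤m _ _) t s)))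
               (*-identityˡ (δ t s)))) ⟩
        ∑ r (λ t → a t * (c * δ t s))
          ≡⟨ ∑-cong r (λ t → trans (sym (*-assoc (a t) c _)) (*-comm _ _)) ⟩
        ∑ r (λ t → δ t s * (a t * c))   ≡⟨ ∑-δ r s (λ t → a t * c) ⟩
        a s * c                         ∎ where open ≡-Reasoning

      independent : ∀ a → (∀ k → lincomb r a b k ≡ 0#) → ∀ s → a s ≡ 0#
      independent a lc≡0 s = vanishes (representative (e≢0 i₀) (e≢0 (col s)))
        where
        vanishes : ∃[ κ ] ∃[ c ] (c ≢ 0# × (∀ i j → M̂ κ i j ≡ c * outer (e i₀) (e (col s)) i j)) → a s ≡ 0#
        vanishes (κ , c , c≢0 , M̂≡cuv) =
          *-cancelʳ c≢0 (trans (sym (lincomb-at-unit a s κ c M̂≡cuv)) (trans (lc≡0 κ) (sym (zeroˡ c))))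

      basis : IsSubcodeBasis (Cdet M̂) r b
      basis = (λ t → X t , λ _ → refl) , independent

      Q : Mat ℓ m → Set
      Q N = ∃[ t ] (N i₀ (col t) ≢ 0#)

      Q? : ∀ N → Dec (Q N)
      Q? N = Finₚ.any? (λ t → ¬? (N i₀ (col t) ≟ 0#))

      Q-invariant : ∀ {M N} → ScalarMultiple M N → Q N → Q M
      Q-invariant (c , c≢0 , M≡cN) (t , Nᵢⱼ≢0) = t , λ Mᵢⱼ≡0 → *-≢0 c≢0 Nᵢⱼ≢0 (trans (sym (M≡cN i₀ (col t))) Mᵢⱼ≡0)

      support≡Q : ∀ k → 𝟙 (inSupport? b k) ≡ 𝟙 (Q? (M̂ k))
      support≡Q k = 𝟙-cong (inSupport? b k) (Q? (M̂ k))
        (λ sup → let (t , bₜₖ≢0) = nonzero-entry (column b k) (support⇒column b k sup) in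
                 t , λ e′ → bₜₖ≢0 (trans (Vecₚ.lookup∘tabulate (λ t → b t k) t) (trans (eval-X t (M̂ k)) e′)))
        (λ (t , M̂≢0) → column⇒support b k (entry⇒nonzero (column b k) t
          (λ e′ → M̂≢0 (trans (sym (eval-X t (M̂ k))) (trans (sym (Vecₚ.lookup∘tabulate (λ t → b t k) t)) e′)))))

      Q-outer : ∀ u v → Q (outer u v) → lookup u i₀ ≢ 0# × ¬ ZeroPrefix r v
      Q-outer u v (t , uv≢0) = ≢0-factorˡ uv≢0 , λ zp → ≢0-factorʳ uv≢0 (zeroPrefix⇒ r v zp (col t) (col<r t))

      outer-Q : ∀ u v → lookup u i₀ ≢ 0# → ¬ ZeroPrefix r v → Q (outer u v)
      outer-Q u v uᵢ₀≢0 ¬zp with Finₚ.any? (λ t → ¬? (lookup v (col t) ≟ 0#))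
      ... | yes (t , vₜ≢0) = t , *-≢0 uᵢ₀≢0 vₜ≢0
      ... | no none = ⊥-elim (¬zp (⇒zeroPrefix r v λ j j<r →
        subst (λ j′ → lookup v j′ ≡ 0#)
              (Finₚ.toℕ-injective (trans (Finₚ.toℕ-inject≤ _ r≤m) (Finₚ.toℕ-fromℕ< j<r)))
              (Dec.decidable-stable (lookup v (col (Fin.fromℕ< j<r)) ≟ 0#) (λ ne → none (_ , ne)))))

      pair-indicator : ∀ u v → 𝟙 (¬? (u ≟v 0v ℓ)) ℕ.* 𝟙 (¬? (v ≟v 0v m)) ℕ.* 𝟙 (Q? (outer u v))
                              ≡ 𝟙 (¬? (e i₀ · u ≟ 0#)) ℕ.* 𝟙 (¬? (zeroPrefix? r v))
      pair-indicator u v = begin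
        𝟙 (¬? (u ≟v 0v ℓ)) ℕ.* 𝟙 (¬? (v ≟v 0v m)) ℕ.* 𝟙 (Q? (outer u v))
          ≡⟨ cong (ℕ._* 𝟙 (Q? (outer u v))) (sym (𝟙-× (¬? (u ≟v 0v ℓ)) (¬? (v ≟v 0v m)))) ⟩
        𝟙 (¬? (u ≟v 0v ℓ) ×-dec ¬? (v ≟v 0v m)) ℕ.* 𝟙 (Q? (outer u v))
          ≡⟨ 𝟙-absorb (¬? (u ≟v 0v ℓ) ×-dec ¬? (v ≟v 0v m)) (Q? (outer u v)) Q⇒nonzero ⟩
        𝟙 (Q? (outer u v))
          ≡⟨ 𝟙-cong (Q? (outer u v)) (¬? (e i₀ · u ≟ 0#) ×-dec ¬? (zeroPrefix? r v))
               (λ Q-uv → let (uᵢ₀≢0 , ¬zp) = Q-outer u v Q-uv in (λ e′ → uᵢ₀≢0 (trans (sym (e·u i₀ u)) e′)) , ¬zp)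
               (λ (eu≢0 , ¬zp) → outer-Q u v (λ e′ → eu≢0 (trans (e·u i₀ u) e′)) ¬zp) ⟩
        𝟙 (¬? (e i₀ · u ≟ 0#) ×-dec ¬? (zeroPrefix? r v))
          ≡⟨ 𝟙-× (¬? (e i₀ · u ≟ 0#)) (¬? (zeroPrefix? r v)) ⟩
        𝟙 (¬? (e i₀ · u ≟ 0#)) ℕ.* 𝟙 (¬? (zeroPrefix? r v)) ∎
        where
        open ≡-Reasoning
        Q⇒nonzero : Q (outer u v) → u ≢ 0v ℓ × v ≢ 0v m
        Q⇒nonzero Q-uv with Q-outer u v Q-uv
        ... | uᵢ₀≢0 , ¬zp = (λ { refl → uᵢ₀≢0 (Vecₚ.lookup-replicate i₀ 0#) })
                          , (λ { refl → ¬zp (⇒zeroPrefix r (0v m) (λ j _ → Vecₚ.lookup-replicate j 0#)) })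

      support-count : supportSize b ℕ.* ((q ∸ 1) ℕ.* (q ∸ 1)) ≡ q ^ (ℓ ∸ 1) ℕ.* (q ∸ 1) ℕ.* (q ^ (m ∸ r) ℕ.* (q ^ r ∸ 1))
      support-count = begin
        supportSize b ℕ.* ((q ∸ 1) ℕ.* (q ∸ 1))
          ≡⟨ cong (ℕ._* _) (sum-cong-≗ support≡Q) ⟩
        ∑[ k < n̂ ] 𝟙 (Q? (M̂ k)) ℕ.* ((q ∸ 1) ℕ.* (q ∸ 1))
          ≡⟨ sym (orbit-count Q? Q-invariant) ⟩
        ∑V ℓ (λ u → ∑V m (λ v → 𝟙 (¬? (u ≟v 0v ℓ)) ℕ.* 𝟙 (¬? (v ≟v 0v m)) ℕ.* 𝟙 (Q? (outer u v))))
          ≡⟨ ∑V-cong ℓ (λ u → ∑V-cong m (pair-indicator u)) ⟩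
        ∑V ℓ (λ u → ∑V m (λ v → 𝟙 (¬? (e i₀ · u ≟ 0#)) ℕ.* 𝟙 (¬? (zeroPrefix? r v))))
          ≡⟨ ∑V-product ℓ m _ _ ⟩
        ∑V ℓ (λ u → 𝟙 (¬? (e i₀ · u ≟ 0#))) ℕ.* ∑V m (λ v → 𝟙 (¬? (zeroPrefix? r v)))
          ≡⟨ cong₂ ℕ._*_ (nonvanishing-count ℓ (e i₀) (e≢0 i₀)) (nonzeroPrefix-count m r r≤m) ⟩
        q ^ (ℓ ∸ 1) ℕ.* (q ∸ 1) ℕ.* (q ^ (m ∸ r) ℕ.* (q ^ r ∸ 1)) ∎ where open ≡-Reasoning

    module Trace (r : ℕ) (ℓ≤m : ℓ ≤ m) where

      diag : Fin ℓ → Fin m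
      diag i = Fin.inject≤ i ℓ≤m

      τ-on : ∀ (i : Fin ℓ) (j : Fin m) → toℕ i ≡ toℕ j → toℕ i < r → τ r i j ≡ 1#
      τ-on i j i≡j i<r with toℕ i ℕ.≟ toℕ j | toℕ i ℕ.<? r
      ... | yes _   | yes _  = refl
      ... | no i≢j  | _      = ⊥-elim (i≢j i≡j)
      ... | yes _   | no i≮r = ⊥-elim (i≮r i<r)

      τ-off : ∀ (i : Fin ℓ) (j : Fin m) → toℕ i ≢ toℕ j → τ r i j ≡ 0#
      τ-off i j i≢j with toℕ i ℕ.≟ toℕ j
      ... | yes i≡j = ⊥-elim (i≢j i≡j)
      ... | no _    = refl

      τ-beyond : ∀ (i : Fin ℓ) (j : Fin m) → ¬ toℕ i < r → τ r i j ≡ 0#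
      τ-beyond i j i≮r with toℕ i ℕ.≟ toℕ j | toℕ i ℕ.<? r
      ... | yes _ | yes i<r = ⊥-elim (i≮r i<r)
      ... | yes _ | no _    = refl
      ... | no _  | _       = refl

      -- uᵀ τ_r = (u₁, …, u_r, 0, …, 0), so it vanishes iff u has a zero prefix of length r.
      zeroPrefix⇒uᵀτ≡0 : ∀ u → ZeroPrefix r u → rowComb (τ r) u ≡ 0v m
      zeroPrefix⇒uᵀτ≡0 u zp = vec-ext λ j → trans (Vecₚ.lookup∘tabulate _ j)
        (trans (∑-zero ℓ (λ i → term i j (toℕ i ℕ.<? r))) (sym (Vecₚ.lookup-replicate j 0#)))
        where
        term : ∀ i j → Dec (toℕ i < r) → τ r i j * lookup u i ≡ 0#
        term i j (yes i<r) = trans (cong (τ r i j *_) (zeroPrefix⇒ r u zp i i<r)) (zeroʳ _)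
        term i j (no i≮r)  = trans (cong (_* lookup u i) (τ-beyond i j i≮r)) (zeroˡ _)

      uᵀτ≡0⇒zeroPrefix : ∀ u → rowComb (τ r) u ≡ 0v m → ZeroPrefix r u
      uᵀτ≡0⇒zeroPrefix u uᵀτ≡0 = ⇒zeroPrefix r u λ i i<r → begin
        lookup u i                                        ≡⟨ sym (∑-δ ℓ i (lookup u)) ⟩
        ∑ ℓ (λ i′ → δ i′ i * lookup u i′)                 ≡⟨ ∑-cong ℓ (λ i′ → cong (_* lookup u i′) (sym (τ-diag i i′ i<r (i′ Finₚ.≟ i)))) ⟩
        ∑ ℓ (λ i′ → τ r i′ (diag i) * lookup u i′)        ≡⟨ sym (Vecₚ.lookup∘tabulate _ (diag i)) ⟩
        lookup (rowComb (τ r) u) (diag i)                 ≡⟨ cong (λ x → lookup x (diag i)) uᵀτ≡0 ⟩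
        lookup (0v m) (diag i)                            ≡⟨ Vecₚ.lookup-replicate (diag i) 0# ⟩
        0#                                                ∎
        where
        open ≡-Reasoning
        τ-diag : ∀ i i′ → toℕ i < r → Dec (i′ ≡ i) → τ r i′ (diag i) ≡ δ i′ i
        τ-diag i i′ i<r (yes refl) = trans (τ-on i′ (diag i′) (sym (Finₚ.toℕ-inject≤ i′ ℓ≤m)) i<r) (sym (δ-same i′))
        τ-diag i i′ i<r (no i′≢i)  = trans (τ-off i′ (diag i) λ e → i′≢i (Finₚ.toℕ-injective (trans e (Finₚ.toℕ-inject≤ i ℓ≤m))))
                               (sym (δ-diff i′ i i′≢i))

      τ-weight : r ≤ ℓ → weight (τ r) ℕ.* ((q ∸ 1) ℕ.* (q ∸ 1)) ≡ q ^ (ℓ ∸ r) ℕ.* (q ^ r ∸ 1) ℕ.* (q ^ (m ∸ 1) ℕ.* (q ∸ 1))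
      τ-weight r≤ℓ = trans (weight-formula (τ r)) (cong (ℕ._* _) (trans
        (∑V-cong ℓ (λ u → 𝟙-cong (¬? (rowComb (τ r) u ≟v 0v m)) (¬? (zeroPrefix? r u))
          (λ ne zp → ne (zeroPrefix⇒uᵀτ≡0 u zp)) (λ ¬zp uᵀτ≡0 → ¬zp (uᵀτ≡0⇒zeroPrefix u uᵀτ≡0))))
        (nonzeroPrefix-count ℓ r r≤ℓ)))

-- From here on + and * are the operations of ℕ (inside OverFq they were those of F).
open import Data.Nat using (_+_; _*_)

sumℕ-snoc : ∀ r f → sumℕ (suc r) f ≡ sumℕ r f + f r
sumℕ-snoc r f = begin
  ListAction.sum (List.map f (List.upTo (suc r)))               ≡⟨ cong (λ xs → ListAction.sum (List.map f xs)) (sym (Listₚ.upTo-∷ʳ r)) ⟩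
  ListAction.sum (List.map f (List.upTo r List.∷ʳ r))           ≡⟨ cong ListAction.sum (Listₚ.map-++ f (List.upTo r) (List.[ r ])) ⟩
  ListAction.sum (List.map f (List.upTo r) List.++ List.[ f r ]) ≡⟨ ListActionₚ.sum-++ (List.map f (List.upTo r)) _ ⟩
  sumℕ r f + (f r + 0)                                          ≡⟨ cong (sumℕ r f +_) (ℕₚ.+-identityʳ (f r)) ⟩
  sumℕ r f + f r                                                ∎ where open ≡-Reasoning

sumℕ-cong< : ∀ r {f g : ℕ → ℕ} → (∀ j → j < r → f j ≡ g j) → sumℕ r f ≡ sumℕ r g
sumℕ-cong< zero    f≗g = refl
sumℕ-cong< (suc r) {f} {g} f≗g = begin
  sumℕ (suc r) f   ≡⟨ sumℕ-snoc r f ⟩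
  sumℕ r f + f r   ≡⟨ cong₂ _+_ (sumℕ-cong< r (λ j j<r → f≗g j (ℕₚ.m<n⇒m<1+n j<r))) (f≗g r (ℕₚ.n<1+n r)) ⟩
  sumℕ r g + g r   ≡⟨ sym (sumℕ-snoc r g) ⟩
  sumℕ (suc r) g   ∎ where open ≡-Reasoning

exact-ceiling : ∀ x d → 1 ≤ d → ⌈ x * d / d ⌉ ≡ x
exact-ceiling x (suc b) _ = begin
  (x * suc b + b) / suc b            ≡⟨ +-distrib-/-∣ˡ b (divides x refl) ⟩
  x * suc b / suc b + b / suc b      ≡⟨ cong₂ _+_ (m*n/n≡m x (suc b)) (m<n⇒m/n≡0 (ℕₚ.n<1+n b)) ⟩
  x + 0                              ≡⟨ ℕₚ.+-identityʳ x ⟩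
  x                                  ∎ where open ≡-Reasoning

module GeometricSeries (q : ℕ) (q≥1 : 1 ≤ q) where

  q^n≥1 : ∀ n → 1 ≤ q ^ n
  q^n≥1 zero    = s≤s z≤n
  q^n≥1 (suc n) = ℕₚ.*-mono-≤ q≥1 (q^n≥1 n)

  pow-split : ∀ a b {c} → a + b ≡ c → q ^ a * q ^ b ≡ q ^ c
  pow-split a b a+b≡c = trans (sym (ℕₚ.^-distribˡ-+-* q a b)) (cong (q ^_) a+b≡c)

  geometric-telescope : ∀ N r → r ≤ suc N → sumℕ r (λ j → q ^ (N ∸ j)) * (q ∸ 1) + q ^ (suc N ∸ r) ≡ q ^ suc N
  geometric-telescope N zero    _         = refl
  geometric-telescope N (suc r) (s≤s r≤N) = begin
    sumℕ (suc r) G * (q ∸ 1) + q ^ (N ∸ r)           ≡⟨ cong (λ x → x * (q ∸ 1) + q ^ (N ∸ r)) (sumℕ-snoc r G) ⟩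
    (S + q ^ (N ∸ r)) * (q ∸ 1) + q ^ (N ∸ r)        ≡⟨ cong (_+ q ^ (N ∸ r)) (ℕₚ.*-distribʳ-+ (q ∸ 1) S (q ^ (N ∸ r))) ⟩
    S * (q ∸ 1) + q ^ (N ∸ r) * (q ∸ 1) + q ^ (N ∸ r) ≡⟨ ℕₚ.+-assoc (S * (q ∸ 1)) _ _ ⟩
    S * (q ∸ 1) + (q ^ (N ∸ r) * (q ∸ 1) + q ^ (N ∸ r)) ≡⟨ cong (S * (q ∸ 1) +_) last-term ⟩
    S * (q ∸ 1) + q ^ (suc N ∸ r)                    ≡⟨ geometric-telescope N r (ℕₚ.m≤n⇒m≤1+n r≤N) ⟩
    q ^ suc N                                        ∎
    where
    open ≡-Reasoning
    G : ℕ → ℕ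
    G j = q ^ (N ∸ j)
    S : ℕ
    S = sumℕ r G
    last-term : q ^ (N ∸ r) * (q ∸ 1) + q ^ (N ∸ r) ≡ q ^ (suc N ∸ r)
    last-term = begin
      q ^ (N ∸ r) * (q ∸ 1) + q ^ (N ∸ r)       ≡⟨ cong (q ^ (N ∸ r) * (q ∸ 1) +_) (sym (ℕₚ.*-identityʳ _)) ⟩
      q ^ (N ∸ r) * (q ∸ 1) + q ^ (N ∸ r) * 1   ≡⟨ sym (ℕₚ.*-distribˡ-+ (q ^ (N ∸ r)) (q ∸ 1) 1) ⟩
      q ^ (N ∸ r) * (q ∸ 1 + 1)                 ≡⟨ cong (q ^ (N ∸ r) *_) (ℕₚ.m∸n+n≡m q≥1) ⟩
      q ^ (N ∸ r) * q                           ≡⟨ ℕₚ.*-comm (q ^ (N ∸ r)) q ⟩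
      q ^ suc (N ∸ r)                           ≡⟨ cong (q ^_) (sym (ℕₚ.+-∸-assoc 1 r≤N)) ⟩
      q ^ (suc N ∸ r)                           ∎

  geometric : ∀ N r → r ≤ suc N → sumℕ r (λ j → q ^ (N ∸ j)) * (q ∸ 1) ≡ q ^ (suc N ∸ r) * (q ^ r ∸ 1)
  geometric N r r≤N+1 = begin
    X                  ≡⟨ sym (ℕₚ.m+n∸n≡m X Y) ⟩
    X + Y ∸ Y          ≡⟨ cong (_∸ Y) (geometric-telescope N r r≤N+1) ⟩
    q ^ suc N ∸ Y      ≡⟨ cong₂ _∸_ (sym (pow-split (suc N ∸ r) r (ℕₚ.m∸n+n≡m r≤N+1))) (sym (ℕₚ.*-identityʳ Y)) ⟩
    Y * q ^ r ∸ Y * 1  ≡⟨ sym (ℕₚ.*-distribˡ-∸ Y (q ^ r) 1) ⟩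
    Y * (q ^ r ∸ 1)    ∎
    where
    open ≡-Reasoning
    X Y : ℕ
    X = sumℕ r (λ j → q ^ (N ∸ j)) * (q ∸ 1)
    Y = q ^ (suc N ∸ r)

  ceiling-power : ∀ N j → j ≤ N → ⌈ q ^ N / q ^ j ⌉ ≡ q ^ (N ∸ j)
  ceiling-power N j j≤N =
    trans (cong (λ x → ⌈ x / q ^ j ⌉) (sym (pow-split (N ∸ j) j (ℕₚ.m∸n+n≡m j≤N)))) (exact-ceiling _ (q ^ j) (q^n≥1 j))

  ceiling-sum : ∀ N r → r ≤ suc N → sumℕ r (λ j → q ^ (N ∸ j)) ≡ sumℕ r (λ j → ⌈ q ^ N / q ^ j ⌉)
  ceiling-sum N r r≤N+1 = sumℕ-cong< r (λ j j<r → sym (ceiling-power N j (ℕₚ.≤-pred (ℕₚ.≤-trans j<r r≤N+1))))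

-- The theorem for ℓ = ℓ′ + 1 ≤ m = m′ + 1 and r = r′ + 1 ≤ m, with N = ℓ + m - 2 = ℓ′ + m′.
module Main {q : ℕ} (F : FiniteField q) {ℓ′ m′ n̂ : ℕ} (M̂ : Fin n̂ → OverField.Mat F (suc ℓ′) (suc m′))
            (reps : OverField.IsProjReps F M̂) (ℓ≤m : ℓ′ ≤ m′) (r′ : ℕ) (r≤m : r′ ≤ m′) where
  open OverField F
  open OverFq F using (q≥2; q∸1>0; inSupport?; module Representatives)
  open Representatives M̂ reps
  open GeometricSeries q (ℕₚ.≤-trans (s≤s z≤n) q≥2)

  r N : ℕ
  r = suc r′
  N = ℓ′ + m′

  d : ℕ
  d = sumℕ r (λ j → q ^ (N ∸ j))

  r≤N+1 : r ≤ suc N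
  r≤N+1 = s≤s (ℕₚ.≤-trans r≤m (ℕₚ.m≤n+m m′ ℓ′))

  d-geometric : d * (q ∸ 1) ≡ q ^ (N ∸ r′) * (q ^ r ∸ 1)
  d-geometric = geometric N r r≤N+1

  d·q∸1² : d * ((q ∸ 1) * (q ∸ 1)) ≡ q ^ (N ∸ r′) * ((q ^ r ∸ 1) * (q ∸ 1))
  d·q∸1² = begin
    d * ((q ∸ 1) * (q ∸ 1))                ≡⟨ sym (ℕₚ.*-assoc d (q ∸ 1) (q ∸ 1)) ⟩
    d * (q ∸ 1) * (q ∸ 1)                  ≡⟨ cong (_* (q ∸ 1)) d-geometric ⟩
    q ^ (N ∸ r′) * (q ^ r ∸ 1) * (q ∸ 1)   ≡⟨ ℕₚ.*-assoc (q ^ (N ∸ r′)) _ _ ⟩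
    q ^ (N ∸ r′) * ((q ^ r ∸ 1) * (q ∸ 1)) ∎ where open ≡-Reasoning

  -- Both counts of the construction have the form q^a x · q^b y with a + b = N - r′
  -- and x y = (q^r - 1)(q - 1); each is therefore (q - 1)² d.
  as-d·q∸1² : ∀ a b x y → a + b ≡ N ∸ r′ → x * y ≡ (q ^ r ∸ 1) * (q ∸ 1) →
                q ^ a * x * (q ^ b * y) ≡ d * ((q ∸ 1) * (q ∸ 1))
  as-d·q∸1² a b x y a+b≡ xy≡ = begin
    q ^ a * x * (q ^ b * y)  ≡⟨ ℕ-interchange (q ^ a) x (q ^ b) y ⟩
    q ^ a * q ^ b * (x * y)  ≡⟨ cong₂ _*_ (pow-split a b a+b≡) xy≡ ⟩
    q ^ (N ∸ r′) * ((q ^ r ∸ 1) * (q ∸ 1)) ≡⟨ sym d·q∸1² ⟩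
    d * ((q ∸ 1) * (q ∸ 1))  ∎ where open ≡-Reasoning

  cancel-q∸1² : ∀ x → x * ((q ∸ 1) * (q ∸ 1)) ≡ d * ((q ∸ 1) * (q ∸ 1)) → x ≡ d
  cancel-q∸1² x = ℕₚ.*-cancelʳ-≡ x d _ {{OverFq.q∸1²≢0 F}}

  attained : ∃[ b ] (IsSubcodeBasis (Cdet M̂) r b × SupportWeight r b d)
  attained = b , basis , subst (SupportWeight r b)
    (cancel-q∸1² _ (trans support-count (as-d·q∸1² ℓ′ (m′ ∸ r′) (q ∸ 1) (q ^ r ∸ 1)
      (sym (ℕₚ.+-∸-assoc ℓ′ r≤m)) (ℕₚ.*-comm (q ∸ 1) _))))
    (∑⇒Count (inSupport? b))
    where open ExplicitSubcode zero r (s≤s r≤m)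

  lower : ∀ b s → IsSubcodeBasis (Cdet M̂) r b → SupportWeight r b s → d ≤ s
  lower b s basis ‖D‖≡s = ℕₚ.*-cancelʳ-≤ d s (q ^ r′ * (q ∸ 1)) {{nonzero}} (begin
    d * (q ^ r′ * (q ∸ 1))                 ≡⟨ ℕ-leftComm d (q ^ r′) (q ∸ 1) ⟩
    q ^ r′ * (d * (q ∸ 1))                 ≡⟨ cong (q ^ r′ *_) d-geometric ⟩
    q ^ r′ * (q ^ (N ∸ r′) * (q ^ r ∸ 1))  ≡⟨ sym (ℕₚ.*-assoc (q ^ r′) _ _) ⟩
    q ^ r′ * q ^ (N ∸ r′) * (q ^ r ∸ 1)    ≡⟨ cong (_* (q ^ r ∸ 1)) (trans (pow-split r′ (N ∸ r′) (ℕₚ.m+[n∸m]≡n r′≤N))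
                                                                         (sym (pow-split ℓ′ m′ refl))) ⟩
    q ^ ℓ′ * q ^ m′ * (q ^ r ∸ 1)          ≡⟨ ℕₚ.*-comm (q ^ ℓ′ * q ^ m′) _ ⟩
    (q ^ r ∸ 1) * (q ^ ℓ′ * q ^ m′)        ≤⟨ support-lower-bound r b s basis ‖D‖≡s ⟩
    s * (q ^ r′ * (q ∸ 1))                 ∎)
    where
    open ℕₚ.≤-Reasoning
    r′≤N : r′ ≤ N
    r′≤N = ℕₚ.≤-pred r≤N+1
    nonzero : NonZero (q ^ r′ * (q ∸ 1))
    nonzero = ℕ.>-nonZero (ℕₚ.*-mono-< (q^n≥1 r′) q∸1>0)

  τ-weight-d : r ≤ suc ℓ′ → HammingWeight (codeword M̂ (τ r)) d
  τ-weight-d (s≤s r′≤ℓ′) = subst (HammingWeight (codeword M̂ (τ r)))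
    (cancel-q∸1² _ (trans (τ-weight (s≤s r′≤ℓ′)) (as-d·q∸1² (ℓ′ ∸ r′) m′ (q ^ r ∸ 1) (q ∸ 1)
      (sym (ℕₚ.+-∸-comm m′ r′≤ℓ′)) refl)))
    (∑⇒Count (λ k → eval≢0? (τ r) (M̂ k)))
    where open Trace r (s≤s ℓ≤m)

  -- The four claims of the theorem, with the exponents N = ℓ + m - 2 and
  -- E = ℓ + m - r - 1 left abstract.
  Claims : ℕ → ℕ → Set
  Claims n e = IsGHW (Cdet M̂) r (sumℕ r (λ j → q ^ (n ∸ j)))
             × sumℕ r (λ j → q ^ (n ∸ j)) ≡ sumℕ r (λ j → ⌈ q ^ n / q ^ j ⌉)
             × sumℕ r (λ j → q ^ (n ∸ j)) * (q ∸ 1) ≡ q ^ e * (q ^ r ∸ 1)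
             × (r ≤ suc ℓ′ → HammingWeight (codeword M̂ (τ r)) (sumℕ r (λ j → q ^ (n ∸ j))))

  claims : Claims N (N ∸ r′)
  claims = (attained , lower) , ceiling-sum N r r≤N+1 , d-geometric , τ-weight-d

theorem4p4 :
    (q : ℕ) → (∃[ p ] ∃[ k ] (Prime p × q ≡ p ^ k)) → (F : FiniteField q) →
    (ℓ m : ℕ) → 1 ≤ ℓ → ℓ ≤ m →
    (n̂ : ℕ) → (M̂ : Fin n̂ → OverField.Mat F ℓ m) → OverField.IsProjReps F M̂ →
    (r : ℕ) → 1 ≤ r → r ≤ m →
    OverField.IsGHW F (OverField.Cdet F M̂) r (sumℕ r (λ j → q ^ (ℓ + m ∸ 2 ∸ j)))
    × sumℕ r (λ j → q ^ (ℓ + m ∸ 2 ∸ j))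
        ≡ sumℕ r (λ j → ⌈ q ^ (ℓ + m ∸ 2) / q ^ j ⌉)
    × sumℕ r (λ j → q ^ (ℓ + m ∸ 2 ∸ j)) * (q ∸ 1)
        ≡ q ^ (ℓ + m ∸ r ∸ 1) * (q ^ r ∸ 1)
    × (r ≤ ℓ → OverField.HammingWeight F (OverField.codeword F M̂ (OverField.τ F r))
                 (sumℕ r (λ j → q ^ (ℓ + m ∸ 2 ∸ j))))
theorem4p4 q _ F (suc ℓ′) (suc m′) _ (s≤s ℓ′≤m′) n̂ M̂ reps (suc r′) _ (s≤s r′≤m′) =
  subst₂ Claims (sym N≡) (sym E≡) claims
  where
  open Main F M̂ reps ℓ′≤m′ r′ r′≤m′
  N≡ : suc ℓ′ + suc m′ ∸ 2 ≡ ℓ′ + m′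
  N≡ = cong (_∸ 1) (ℕₚ.+-suc ℓ′ m′)
  E≡ : suc ℓ′ + suc m′ ∸ suc r′ ∸ 1 ≡ ℓ′ + m′ ∸ r′
  E≡ = begin
    ℓ′ + suc m′ ∸ r′ ∸ 1      ≡⟨ cong (λ x → x ∸ r′ ∸ 1) (ℕₚ.+-suc ℓ′ m′) ⟩
    suc (ℓ′ + m′) ∸ r′ ∸ 1    ≡⟨ ℕₚ.∸-+-assoc (suc (ℓ′ + m′)) r′ 1 ⟩
    suc (ℓ′ + m′) ∸ (r′ + 1)  ≡⟨ cong (suc (ℓ′ + m′) ∸_) (ℕₚ.+-comm r′ 1) ⟩
    ℓ′ + m′ ∸ r′              ∎ where open ≡-Reasoning
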